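{- For infinitely many integers $d$, there exists a $d$-regular graph of girth six with no induced subdivision of $K_{d+1}$.
   Context: All graphs are finite and simple. Girth is the length of a shortest cycle. A subdivision of $H$ is obtained by replacing each edge of $H$ by a path, these paths being internally vertex-disjoint; a graph contains an induced subdivision of $H$ if some induced subgraph is isomorphic to a subdivision of $H$. -}

module Defs where

open import Data.Nat using (ℕ; zero; suc; _≤_; _<_)
open import Data.Fin using (Fin; toℕ; inject₁; fromℕ) renaming (zero to fzero; suc to fsuc; _<_ to _<ᶠ_)
open import Data.Fin.Properties using (_≟_)
open import Data.Bool using (Bool; true; false; not)
open import Data.List using (List; length; filterᵇ; allFin)
open import Data.Product using (Σ; ∃; ∃-syntax; _×_; _,_)
open import Data.Sum using (_⊎_)
open import Relation.Nullary using (¬_; does)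
open import Relation.Binary.PropositionalEquality using (_≡_; refl; sym)
open import Data.Empty using (⊥-elim)
open import Function.Definitions using (Injective)

record Graph : Set where
  field
    n      : ℕ
    adj    : Fin n → Fin n → Bool
    adj-sym    : ∀ x y → adj x y ≡ adj y x
    adj-irrefl : ∀ x → adj x x ≡ false

open Graph public

Vtx : Graph → Set
Vtx G = Fin (n G)

Edge : (G : Graph) → Vtx G → Vtx G → Set
Edge G x y = adj G x y ≡ true

degree : (G : Graph) → Vtx G → ℕ
degree G v = length (filterᵇ (adj G v) (allFin (n G)))

Regular : Graph → ℕ → Set
Regular G d = ∀ v → degree G v ≡ d

HasCycle : Graph → ℕ → Set
HasCycle G k = 3 ≤ k × Σ (Fin k → Vtx G) λ c → Injective _≡_ _≡_ c ×
  (∀ (i j : Fin k) → (suc (toℕ i) ≡ toℕ j ⊎ (suc (toℕ i) ≡ k × toℕ j ≡ 0)) → Edge G (c i) (c j))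

Girth : Graph → ℕ → Set
Girth G g = HasCycle G g × (∀ k → k < g → ¬ HasCycle G k)

complete : ℕ → Graph
complete m = record
  { n = m
  ; adj = λ x y → not (does (x ≟ y))
  ; adj-sym = symK
  ; adj-irrefl = irrK
  }
  where
  open import Relation.Nullary using (yes; no)
  symK : ∀ (x y : Fin m) → not (does (x ≟ y)) ≡ not (does (y ≟ x))
  symK x y with x ≟ y | y ≟ x
  ... | yes _ | yes _ = refl
  ... | no _  | no _  = refl
  ... | yes p | no q  = ⊥-elim (q (sym p))
  ... | no p  | yes q = ⊥-elim (p (sym q))
  irrK : ∀ (x : Fin m) → not (does (x ≟ x)) ≡ false
  irrK x with x ≟ x
  ... | yes _ = refl
  ... | no p  = ⊥-elim (p refl)

-- A path in G with L internal vertices: distinct vertices p 0, …, p (L+1),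
-- consecutive ones adjacent.
record Path (G : Graph) : Set where
  field
    L       : ℕ
    p       : Fin (suc (suc L)) → Vtx G
    inj     : Injective _≡_ _≡_ p
    consec  : ∀ (i : Fin (suc L)) → Edge G (p (inject₁ i)) (p (fsuc i))

open Path public

start end : ∀ {G} → Path G → Vtx G
start P = p P fzero
end   P = p P (fromℕ (suc (L P)))

internal : ∀ {G} (P : Path G) → Fin (L P) → Vtx G
internal P j = p P (fsuc (inject₁ j))

record IsSubdivisionOf (S H : Graph) : Set where
  field
    branch      : Vtx H → Vtx S
    branch-inj  : Injective _≡_ _≡_ branch
    path        : (u v : Vtx H) → u <ᶠ v → Edge H u v → Path S
    path-start  : ∀ u v lt e → start (path u v lt e) ≡ branch u
    path-end    : ∀ u v lt e → end (path u v lt e) ≡ branch v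
    internal-not-branch : ∀ u v lt e j w → ¬ (internal (path u v lt e) j ≡ branch w)
    internal-disjoint   : ∀ u v lt e u' v' lt' e' j j' →
      internal (path u v lt e) j ≡ internal (path u' v' lt' e') j' → (u ≡ u' × v ≡ v')
    covers      : ∀ (x : Vtx S) → (∃[ w ] branch w ≡ x) ⊎
      (∃[ u ] ∃[ v ] Σ (u <ᶠ v) λ lt → Σ (Edge H u v) λ e → ∃[ j ] internal (path u v lt e) j ≡ x)
    edges-on-paths : ∀ (x y : Vtx S) → Edge S x y →
      ∃[ u ] ∃[ v ] Σ (u <ᶠ v) λ lt → Σ (Edge H u v) λ e → Σ (Fin (suc (L (path u v lt e)))) λ i →
        (p (path u v lt e) (inject₁ i) ≡ x × p (path u v lt e) (fsuc i) ≡ y) ⊎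
        (p (path u v lt e) (inject₁ i) ≡ y × p (path u v lt e) (fsuc i) ≡ x)

InducedCopy : Graph → Graph → Set
InducedCopy S G = Σ (Vtx S → Vtx G) λ f → Injective _≡_ _≡_ f × (∀ x y → adj G (f x) (f y) ≡ adj S x y)

ContainsInducedSubdivision : Graph → Graph → Set
ContainsInducedSubdivision G H = ∃[ S ] (IsSubdivisionOf S H × InducedCopy S G)

-- Take d = p + 1 for an odd prime p ≥ 5 and G the incidence graph of the projective plane PG(2, p), its points
-- and lines both indexed by points through a polarity. G is d-regular and bipartite, and two vertices have at
-- most one common neighbour, so its girth is 6. In an induced subdivision H of K_{d+1}, every branch vertex has
-- all its d neighbours in H and every other vertex of H has exactly two neighbours in H. If all branch vertices
-- lie on one side, pairing them through the common neighbours with a fixed non-branch vertex on that side gives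
-- a fixed-point-free involution of the p + 2 branch vertices, impossible as p is odd. Otherwise a branch vertex
-- misses at most one branch vertex of the other side, and chasing common neighbours around it produces either
-- p + 3 branch vertices or a non-branch vertex of H with three neighbours in H.

module Submission where

open import Defs
open import Data.Nat using (ℕ; suc; _≤_; z≤n; s≤s)
import Data.Nat.Properties as ℕₚ
open import Data.Nat.Primality using (Prime)
open import Data.Bool using (false)
open import Data.Product using (Σ; ∃-syntax; _×_; _,_)
open import Relation.Nullary using (¬_)

module FiniteCombinatorics where

  open import Data.Nat using (ℕ; zero; suc; _+_; _*_; _≤_; _<_)
  open import Data.Fin as Fin using (Fin; toℕ; punchIn; punchOut; #_) renaming (zero to fzero; suc to fsuc)
  import Data.Fin.Properties as Finₚ
  open import Data.Bool using (Bool)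
  import Data.Bool.Properties as Boolₚ
  open import Data.List using (List; _++_; length; map; filter; allFin)
  open import Data.List.Properties using (length-++; length-map; length-tabulate)
  open import Data.List.Membership.Propositional using (_∈_)
  open import Data.List.Membership.Propositional.Properties
    using (∈-filter⁺; ∈-filter⁻; ∈-map⁺; ∈-map⁻; ∈-allFin; ∈-++⁺ˡ; ∈-++⁺ʳ)
  open import Data.List.Membership.Propositional.Properties.WithK using (unique∧set⇒bag)
  open import Data.List.Relation.Unary.Unique.Propositional using (Unique)
  import Data.List.Relation.Unary.Unique.Propositional.Properties as Uniqueₚ
  open import Data.List.Relation.Binary.BagAndSetEquality using (∼bag⇒↭)
  open import Data.List.Relation.Binary.Permutation.Propositional.Properties using (↭-length)
  open import Data.Product using (Σ; ∃-syntax; _×_; _,_; proj₂)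
  open import Data.Sum using (_⊎_; inj₁; inj₂)
  open import Data.Empty using (⊥)
  open import Function using (id; _∘_; _⇔_; mk⇔)
  open import Relation.Binary.Definitions using (tri<; tri≈; tri>)
  open import Function.Definitions using (Injective)
  open import Relation.Nullary using (¬_; yes; no; contradiction)
  open import Relation.Binary.PropositionalEquality using (_≡_; _≢_; refl; sym; trans; cong; subst; module ≡-Reasoning)
  open import Relation.Unary using (Pred; Decidable; _∪_)

  injective⇒surjective : ∀ {n} {f : Fin n → Fin n} → Injective _≡_ _≡_ f → ∀ y → ∃[ x ] f x ≡ y
  injective⇒surjective {suc n} {f} f-inj y with Finₚ.any? (λ x → f x Finₚ.≟ y)
  ... | yes hit  = hit
  ... | no  miss = contradiction (Finₚ.injective⇒≤ punchOut∘f-injective) ℕₚ.1+n≰n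
    where
    y≢f : ∀ x → y ≢ f x
    y≢f x eq = miss (x , sym eq)
    punchOut∘f-injective : Injective _≡_ _≡_ (λ x → punchOut (y≢f x))
    punchOut∘f-injective eq = f-inj (Finₚ.punchOut-injective (y≢f _) (y≢f _) eq)

  unique∧set⇒length≡ : ∀ {A : Set} {xs ys : List A} → Unique xs → Unique ys →
    (∀ {x} → x ∈ xs ⇔ x ∈ ys) → length xs ≡ length ys
  unique∧set⇒length≡ xs! ys! xs⇔ys = ↭-length (∼bag⇒↭ (unique∧set⇒bag xs! ys! xs⇔ys))

  Even Odd : ℕ → Set
  Even n = ∃[ c ] n ≡ 2 * c
  Odd n = ∃[ c ] n ≡ suc (2 * c)

  even-or-odd : ∀ n → Even n ⊎ Odd n
  even-or-odd zero = inj₁ (0 , refl)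
  even-or-odd (suc n) with even-or-odd n
  ... | inj₁ (c , refl) = inj₂ (c , refl)
  ... | inj₂ (c , refl) = inj₁ (suc c , cong suc (sym (ℕₚ.+-suc c (c + 0))))

  even⇒¬odd : ∀ {n} → Even n → ¬ Odd n
  even⇒¬odd (c , refl) (k , eq) = ℕₚ.even≢odd c k eq

  odd⇒odd+2 : ∀ {n} → Odd n → Odd (suc (suc n))
  odd⇒odd+2 (k , refl) = suc k , cong suc (sym (ℕₚ.*-suc 2 k))

  consecutive-indices : ∀ {k} (i j : Fin (suc k)) → suc (toℕ i) ≡ toℕ j → ∃[ i′ ] (i ≡ Fin.inject₁ i′ × j ≡ fsuc i′)
  consecutive-indices {suc k} fzero    (fsuc j) e =
    fzero , refl , cong fsuc (Finₚ.toℕ-injective (sym (ℕₚ.suc-injective e)))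
  consecutive-indices {suc k} (fsuc i) (fsuc j) e with consecutive-indices i j (ℕₚ.suc-injective e)
  ... | i′ , refl , refl = fsuc i′ , refl , refl

  -- Fin n splits into the smaller members of the pairs {i, σ i} and their images under σ.
  fixedPointFree-involution⇒even : ∀ {n} (σ : Fin n → Fin n) → (∀ i → σ (σ i) ≡ i) → (∀ i → σ i ≢ i) → Even n
  fixedPointFree-involution⇒even {n} σ σσ≡id σ≢id = length small , (begin
    n                                 ≡⟨ sym (length-tabulate id) ⟩
    length (allFin n)                 ≡⟨ unique∧set⇒length≡ (Uniqueₚ.allFin⁺ n) partition! partition⇔ ⟩
    length (small ++ map σ small)     ≡⟨ length-++ small ⟩
    length small + length (map σ small) ≡⟨ cong (length small +_) (length-map σ small) ⟩
    length small + length small       ≡⟨ cong (length small +_) (sym (ℕₚ.+-identityʳ _)) ⟩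
    2 * length small                  ∎)
    where
    open ≡-Reasoning
    Small : Fin n → Set
    Small i = toℕ i < toℕ (σ i)
    small? : Decidable Small
    small? i = toℕ i ℕₚ.<? toℕ (σ i)
    small : List (Fin n)
    small = filter small? (allFin n)
    σ-injective : Injective _≡_ _≡_ σ
    σ-injective {i} {j} eq = trans (sym (σσ≡id i)) (trans (cong σ eq) (σσ≡id j))
    ∈small⇒Small : ∀ {i} → i ∈ small → Small i
    ∈small⇒Small = proj₂ ∘ ∈-filter⁻ small? {xs = allFin n}
    Small⇒∈small : ∀ {i} → Small i → i ∈ small
    Small⇒∈small = ∈-filter⁺ small? (∈-allFin _)
    Small-σ : ∀ {i} → Small i → ¬ Small (σ i)
    Small-σ {i} i<σi σi<i = ℕₚ.<-asym i<σi (subst (λ j → toℕ (σ i) < toℕ j) (σσ≡id i) σi<i)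
    small-or-σ-small : ∀ i → Small i ⊎ Small (σ i)
    small-or-σ-small i with ℕₚ.<-cmp (toℕ i) (toℕ (σ i))
    ... | tri< lt _ _ = inj₁ lt
    ... | tri≈ _ eq _ = contradiction (Finₚ.toℕ-injective (sym eq)) (σ≢id i)
    ... | tri> _ _ gt = inj₂ (subst (λ j → toℕ (σ i) < toℕ j) (sym (σσ≡id i)) gt)
    partition! : Unique (small ++ map σ small)
    partition! = Uniqueₚ.++⁺ small! (Uniqueₚ.map⁺ σ-injective small!) disjoint
      where
      small! = Uniqueₚ.filter⁺ small? (Uniqueₚ.allFin⁺ n)
      disjoint : ∀ {i} → ¬ (i ∈ small × i ∈ map σ small)
      disjoint (i∈small , i∈σsmall) with ∈-map⁻ σ i∈σsmall
      ... | j , j∈small , refl = Small-σ (∈small⇒Small j∈small) (∈small⇒Small i∈small)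
    partition⇔ : ∀ {i} → i ∈ allFin n ⇔ i ∈ small ++ map σ small
    partition⇔ {i} = mk⇔ to (λ _ → ∈-allFin i)
      where
      to : i ∈ allFin n → i ∈ small ++ map σ small
      to _ with small-or-σ-small i
      ... | inj₁ small-i  = ∈-++⁺ˡ (Small⇒∈small small-i)
      ... | inj₂ small-σi = ∈-++⁺ʳ small (subst (_∈ map σ small) (σσ≡id i) (∈-map⁺ σ (Small⇒∈small small-σi)))

  ≢-same⇒≡ : ∀ {x y z : Bool} → x ≢ z → y ≢ z → y ≡ x
  ≢-same⇒≡ x≢z y≢z = trans (Boolₚ.¬-not y≢z) (sym (Boolₚ.¬-not x≢z))

  three-agree : (b : Fin 5 → Bool) → ∃[ i ] ∃[ j ] ∃[ k ] (i ≢ j × i ≢ k × j ≢ k × b j ≡ b i × b k ≡ b i)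
  three-agree b with b (# 1) Boolₚ.≟ b (# 0) | b (# 2) Boolₚ.≟ b (# 0) | b (# 3) Boolₚ.≟ b (# 0) | b (# 4) Boolₚ.≟ b (# 0)
  ... | yes e₁ | yes e₂ | _      | _      = # 0 , # 1 , # 2 , (λ ()) , (λ ()) , (λ ()) , e₁ , e₂
  ... | yes e₁ | no _   | yes e₃ | _      = # 0 , # 1 , # 3 , (λ ()) , (λ ()) , (λ ()) , e₁ , e₃
  ... | yes e₁ | no _   | no _   | yes e₄ = # 0 , # 1 , # 4 , (λ ()) , (λ ()) , (λ ()) , e₁ , e₄
  ... | yes _  | no n₂  | no n₃  | no n₄  = # 2 , # 3 , # 4 , (λ ()) , (λ ()) , (λ ()) , ≢-same⇒≡ n₂ n₃ , ≢-same⇒≡ n₂ n₄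
  ... | no _   | yes e₂ | yes e₃ | _      = # 0 , # 2 , # 3 , (λ ()) , (λ ()) , (λ ()) , e₂ , e₃
  ... | no _   | yes e₂ | no _   | yes e₄ = # 0 , # 2 , # 4 , (λ ()) , (λ ()) , (λ ()) , e₂ , e₄
  ... | no n₁  | yes _  | no n₃  | no n₄  = # 1 , # 3 , # 4 , (λ ()) , (λ ()) , (λ ()) , ≢-same⇒≡ n₁ n₃ , ≢-same⇒≡ n₁ n₄
  ... | no _   | no _   | yes e₃ | yes e₄ = # 0 , # 3 , # 4 , (λ ()) , (λ ()) , (λ ()) , e₃ , e₄
  ... | no n₁  | no n₂  | yes _  | no n₄  = # 1 , # 2 , # 4 , (λ ()) , (λ ()) , (λ ()) , ≢-same⇒≡ n₁ n₂ , ≢-same⇒≡ n₁ n₄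
  ... | no n₁  | no n₂  | no n₃  | _      = # 1 , # 2 , # 3 , (λ ()) , (λ ()) , (λ ()) , ≢-same⇒≡ n₁ n₂ , ≢-same⇒≡ n₁ n₃

  indices-avoiding : ∀ {k m} (a : Fin (suc m)) → k ≤ m →
    Σ (Fin k → Fin (suc m)) λ f → Injective _≡_ _≡_ f × ∀ i → f i ≢ a
  indices-avoiding a k≤m = (λ i → punchIn a (Fin.inject≤ i k≤m)) ,
    (λ eq → Finₚ.inject≤-injective _ _ _ _ (Finₚ.punchIn-injective a _ _ eq)) ,
    (λ i → Finₚ.punchInᵢ≢i a _)

  indices-avoiding₂ : ∀ {k m} (a b : Fin (suc (suc m))) → a ≢ b → k ≤ m →
    Σ (Fin k → Fin (suc (suc m))) λ f → Injective _≡_ _≡_ f × (∀ i → f i ≢ a) × (∀ i → f i ≢ b)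
  indices-avoiding₂ a b a≢b k≤m with indices-avoiding (punchOut a≢b) k≤m
  ... | f , f-injective , f≢b′ = (punchIn a ∘ f) , f-injective ∘ Finₚ.punchIn-injective a _ _ ,
    (λ i → Finₚ.punchInᵢ≢i a _) ,
    (λ i eq → f≢b′ i (Finₚ.punchIn-injective a _ _ (trans eq (sym (Finₚ.punchIn-punchOut a≢b)))))

  AtMostOne : {A : Set} → Pred A _ → Set
  AtMostOne P = ∀ {a b} → a ≢ b → P a → P b → ⊥

  AtMostTwo : {A : Set} → Pred A _ → Set
  AtMostTwo P = ∀ {a b c} → a ≢ b → a ≢ c → b ≢ c → P a → P b → P c → ⊥

  AtMostTwo-mono : ∀ {A : Set} {P Q : Pred A _} → (∀ {a} → P a → Q a) → AtMostTwo Q → AtMostTwo P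
  AtMostTwo-mono P⊆Q two a≢b a≢c b≢c pa pb pc = two a≢b a≢c b≢c (P⊆Q pa) (P⊆Q pb) (P⊆Q pc)

  atMostOne-∪ : ∀ {A : Set} {P Q : Pred A _} → AtMostOne P → AtMostOne Q → AtMostTwo (P ∪ Q)
  atMostOne-∪ one-P one-Q a≢b a≢c b≢c (inj₁ pa) (inj₁ pb) _         = one-P a≢b pa pb
  atMostOne-∪ one-P one-Q a≢b a≢c b≢c (inj₁ pa) (inj₂ qb) (inj₁ pc) = one-P a≢c pa pc
  atMostOne-∪ one-P one-Q a≢b a≢c b≢c (inj₁ pa) (inj₂ qb) (inj₂ qc) = one-Q b≢c qb qc
  atMostOne-∪ one-P one-Q a≢b a≢c b≢c (inj₂ qa) (inj₁ pb) (inj₁ pc) = one-P b≢c pb pc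
  atMostOne-∪ one-P one-Q a≢b a≢c b≢c (inj₂ qa) (inj₁ pb) (inj₂ qc) = one-Q a≢c qa qc
  atMostOne-∪ one-P one-Q a≢b a≢c b≢c (inj₂ qa) (inj₂ qb) _         = one-Q a≢b qa qb

open FiniteCombinatorics

module ProjectivePlaneGraphs where

  open import Data.Nat using (ℕ; suc; _≤_; _<_; z≤n; s≤s)
  open import Data.Fin as Fin using (Fin; toℕ; #_) renaming (zero to fzero; suc to fsuc)
  import Data.Fin.Properties as Finₚ
  open import Data.Bool using (Bool; true; not)
  import Data.Bool.Properties as Boolₚ
  open import Data.List using (length; filterᵇ; allFin; tabulate)
  open import Data.List.Properties using (length-tabulate)
  open import Data.List.Membership.Propositional using (_∈_)
  open import Data.List.Membership.Propositional.Properties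
    using (∈-filter⁺; ∈-filter⁻; ∈-allFin; ∈-tabulate⁺; ∈-tabulate⁻)
  import Data.List.Relation.Unary.Unique.Propositional.Properties as Uniqueₚ
  open import Data.Vec using (Vec; []; _∷_; lookup)
  open import Data.Vec.Relation.Unary.All using ([]; _∷_)
  open import Data.Vec.Relation.Unary.Unique.Propositional using (Unique; []; _∷_)
  open import Data.Vec.Relation.Unary.Unique.Propositional.Properties using (lookup-injective)
  open import Data.Product using (∃-syntax; _×_; _,_; proj₁; proj₂)
  open import Data.Sum using (_⊎_; inj₁; inj₂)
  open import Data.Empty using (⊥-elim)
  open import Function using (_∘_; _⇔_; mk⇔; Equivalence)
  open import Function.Definitions using (Injective)
  open import Relation.Unary using (Pred; Decidable; _∩_; _∪_)
  open import Relation.Nullary using (¬_; Dec; yes; no)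
  open import Relation.Nullary.Decidable using (T?)
  open import Relation.Binary.PropositionalEquality using (_≡_; _≢_; refl; sym; trans; cong; subst; module ≡-Reasoning)

  module GraphProperties (G : Graph) where

    Edge-sym : ∀ {x y} → Edge G x y → Edge G y x
    Edge-sym {x} {y} = trans (adj-sym G y x)

    Edge-irrefl : ∀ {x} → ¬ Edge G x x
    Edge-irrefl {x} e with trans (sym (adj-irrefl G x)) e
    ... | ()

    Edge⇒≢ : ∀ {x y} → Edge G x y → x ≢ y
    Edge⇒≢ e refl = Edge-irrefl e

    Edge? : ∀ x y → Dec (Edge G x y)
    Edge? x y = adj G x y Boolₚ.≟ true

    closed-walk⇒HasCycle : ∀ {k} (c : Fin (suc k) → Vtx G) → 2 ≤ k → Injective _≡_ _≡_ c →
      (∀ i → Edge G (c (Fin.inject₁ i)) (c (fsuc i))) → Edge G (c (Fin.fromℕ k)) (c fzero) → HasCycle G (suc k)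
    closed-walk⇒HasCycle {k} c 2≤k c-injective step close = s≤s 2≤k , c , c-injective , edge
      where
      edge : ∀ i j → suc (toℕ i) ≡ toℕ j ⊎ (suc (toℕ i) ≡ suc k × toℕ j ≡ 0) → Edge G (c i) (c j)
      edge i j (inj₁ e) with consecutive-indices i j e
      ... | i′ , refl , refl = step i′
      edge i j (inj₂ (e , j≡0)) rewrite Finₚ.toℕ-injective {i = i} (trans (ℕₚ.suc-injective e) (sym (Finₚ.toℕ-fromℕ k)))
                                     | Finₚ.toℕ-injective {i = j} {j = fzero} j≡0 = close

  record NeighbourEnumeration (G : Graph) (d : ℕ) : Set where
    field
      nbr            : Vtx G → Fin d → Vtx G
      nbr-edge       : ∀ x i → Edge G x (nbr x i)
      nbr-injective  : ∀ x → Injective _≡_ _≡_ (nbr x)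
      nbr-surjective : ∀ {x y} → Edge G x y → ∃[ i ] nbr x i ≡ y

  neighbours-saturated : ∀ {G d} → NeighbourEnumeration G d → ∀ {x} (g : Fin d → Vtx G) → Injective _≡_ _≡_ g →
    (∀ i → Edge G x (g i)) → ∀ {y} → Edge G x y → ∃[ i ] g i ≡ y
  neighbours-saturated E {x} g g-injective xg {y} xy = i , (begin
    g i                             ≡⟨ sym (index-spec i) ⟩
    nbr x (index i)                 ≡⟨ cong (nbr x) (proj₂ hit) ⟩
    nbr x (proj₁ (nbr-surjective xy)) ≡⟨ proj₂ (nbr-surjective xy) ⟩
    y                               ∎)
    where
    open NeighbourEnumeration E
    open ≡-Reasoning
    index : _ → _
    index i = proj₁ (nbr-surjective (xg i))
    index-spec : ∀ i → nbr x (index i) ≡ g i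
    index-spec i = proj₂ (nbr-surjective (xg i))
    index-injective : Injective _≡_ _≡_ index
    index-injective {i} {j} eq = g-injective (trans (sym (index-spec i)) (trans (cong (nbr x) eq) (index-spec j)))
    hit = injective⇒surjective index-injective (proj₁ (nbr-surjective xy))
    i = proj₁ hit

  enumeration⇒regular : ∀ {G d} → NeighbourEnumeration G d → Regular G d
  enumeration⇒regular {G} {d} E x = begin
    degree G x                ≡⟨ unique∧set⇒length≡ neighbours! (Uniqueₚ.tabulate⁺ (nbr-injective x)) same-members ⟩
    length (tabulate (nbr x)) ≡⟨ length-tabulate (nbr x) ⟩
    d                         ∎
    where
    open NeighbourEnumeration E
    open ≡-Reasoning
    neighbours! = Uniqueₚ.filter⁺ (T? ∘ adj G x) (Uniqueₚ.allFin⁺ (n G))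
    same-members : ∀ {y} → y ∈ filterᵇ (adj G x) (allFin (n G)) ⇔ y ∈ tabulate (nbr x)
    same-members {y} = mk⇔ to from
      where
      to : y ∈ filterᵇ (adj G x) (allFin (n G)) → y ∈ tabulate (nbr x)
      to y∈ with nbr-surjective (Equivalence.to Boolₚ.T-≡ (proj₂ (∈-filter⁻ (T? ∘ adj G x) {xs = allFin (n G)} y∈)))
      ... | i , refl = ∈-tabulate⁺ i
      from : y ∈ tabulate (nbr x) → y ∈ filterᵇ (adj G x) (allFin (n G))
      from y∈ with ∈-tabulate⁻ y∈
      ... | i , refl = ∈-filter⁺ (T? ∘ adj G x) (∈-allFin _) (Equivalence.from Boolₚ.T-≡ (nbr-edge x i))

  record ProjectivePlaneGraph (G : Graph) (q : ℕ) : Set where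
    field
      side                    : Vtx G → Bool
      edge⇒side-flips         : ∀ {x y} → Edge G x y → side y ≡ not (side x)
      neighbours              : NeighbourEnumeration G (suc q)
      common-neighbour        : ∀ {x y} → x ≢ y → side x ≡ side y → ∃[ z ] (Edge G x z × Edge G y z)
      common-neighbour-unique : ∀ {x y z w} → x ≢ y →
        Edge G x z → Edge G y z → Edge G x w → Edge G y w → z ≡ w

    open NeighbourEnumeration neighbours public

  module ProjectivePlaneGraphProperties {G : Graph} {q : ℕ} (PG : ProjectivePlaneGraph G q) where

    open ProjectivePlaneGraph PG public
    open GraphProperties G

    opposite-sides⇒≢ : ∀ {s x y} → side x ≡ s → side y ≡ not s → x ≢ y
    opposite-sides⇒≢ refl sy refl = Boolₚ.not-¬ refl sy

    common-neighbour⇒same-side : ∀ {x y z} → Edge G x z → Edge G y z → side x ≡ side y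
    common-neighbour⇒same-side xz yz = Boolₚ.not-injective (trans (sym (edge⇒side-flips xz)) (edge⇒side-flips yz))

    two-steps : ∀ {x y z} → Edge G x y → Edge G y z → side z ≡ side x
    two-steps xy yz = common-neighbour⇒same-side (Edge-sym yz) xy

    module _ (2≤q : 2 ≤ q) where

      nbr₃ : Vtx G → Fin 3 → Vtx G
      nbr₃ x i = nbr x (Fin.inject≤ i (s≤s 2≤q))

      nbr₃-injective : ∀ x → Injective _≡_ _≡_ (nbr₃ x)
      nbr₃-injective x eq = Finₚ.inject≤-injective _ _ _ _ (nbr-injective x eq)

      nbr₃-distinct : ∀ x {i j} → i ≢ j → nbr₃ x i ≢ nbr₃ x j
      nbr₃-distinct x i≢j = i≢j ∘ nbr₃-injective x

      neighbour-outside : ∀ {P : Pred (Vtx G) _} → Decidable P → ∀ x → AtMostTwo (Edge G x ∩ P) →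
        ∃[ z ] (Edge G x z × ¬ P z)
      neighbour-outside P? x two with P? (nbr₃ x (# 0)) | P? (nbr₃ x (# 1)) | P? (nbr₃ x (# 2))
      ... | no ¬p | _     | _     = nbr₃ x (# 0) , nbr-edge x _ , ¬p
      ... | yes _ | no ¬p | _     = nbr₃ x (# 1) , nbr-edge x _ , ¬p
      ... | yes _ | yes _ | no ¬p = nbr₃ x (# 2) , nbr-edge x _ , ¬p
      ... | yes p₀ | yes p₁ | yes p₂ = ⊥-elim (two (nbr₃-distinct x (λ ())) (nbr₃-distinct x (λ ()))
        (nbr₃-distinct x (λ ())) (nbr-edge x _ , p₀) (nbr-edge x _ , p₁) (nbr-edge x _ , p₂))

      neighbour-avoiding : ∀ x r y → y ≢ x → ∃[ z ] (Edge G x z × z ≢ r × ¬ Edge G z y)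
      neighbour-avoiding x r y y≢x = z , xz , ¬Pz ∘ inj₁ , ¬Pz ∘ inj₂
        where
        P : Pred (Vtx G) _
        P z = z ≡ r ⊎ Edge G z y
        P? : Decidable P
        P? z with z Finₚ.≟ r | Edge? z y
        ... | yes z≡r | _      = yes (inj₁ z≡r)
        ... | no _    | yes zy = yes (inj₂ zy)
        ... | no z≢r  | no ¬zy = no λ { (inj₁ z≡r) → z≢r z≡r ; (inj₂ zy) → ¬zy zy }
        distrib : ∀ {z} → (Edge G x ∩ P) z → ((Edge G x ∩ (_≡ r)) ∪ (Edge G x ∩ (λ z → Edge G z y))) z
        distrib (xz , inj₁ z≡r) = inj₁ (xz , z≡r)
        distrib (xz , inj₂ zy)  = inj₂ (xz , zy)
        two : AtMostTwo (Edge G x ∩ P)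
        two = AtMostTwo-mono distrib (atMostOne-∪ (λ a≢b (_ , a≡r) (_ , b≡r) → a≢b (trans a≡r (sym b≡r)))
          (λ a≢b (xa , ay) (xb , by) → a≢b (common-neighbour-unique (y≢x ∘ sym) xa (Edge-sym ay) xb (Edge-sym by))))
        avoiding = neighbour-outside P? x two
        z = proj₁ avoiding
        xz = proj₁ (proj₂ avoiding)
        ¬Pz = proj₂ (proj₂ avoiding)

      another-neighbour : ∀ x y → ∃[ z ] (Edge G x z × z ≢ y)
      another-neighbour x y with nbr₃ x (# 0) Finₚ.≟ y
      ... | yes refl = nbr₃ x (# 1) , nbr-edge x _ , nbr₃-distinct x (λ ()) ∘ sym
      ... | no  ≢y   = nbr₃ x (# 0) , nbr-edge x _ , ≢y

      hexagon-through : ∀ {x y₁ y₂ z₁ z₂} → y₁ ≢ y₂ → Edge G x y₁ → Edge G x y₂ → Edge G y₁ z₁ → Edge G y₂ z₂ →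
        z₁ ≢ x → z₂ ≢ x → HasCycle G 6
      hexagon-through {x} {y₁} {y₂} {z₁} {z₂} y₁≢y₂ xy₁ xy₂ y₁z₁ y₂z₂ z₁≢x z₂≢x =
        closed-walk⇒HasCycle (lookup walk) (s≤s (s≤s z≤n)) (lookup-injective walk! _ _) step (Edge-sym xy₂)
        where
        s = side x
        sy₁ : side y₁ ≡ not s
        sy₁ = edge⇒side-flips xy₁
        sy₂ : side y₂ ≡ not s
        sy₂ = edge⇒side-flips xy₂
        sz₁ : side z₁ ≡ s
        sz₁ = common-neighbour⇒same-side (Edge-sym y₁z₁) xy₁
        sz₂ : side z₂ ≡ s
        sz₂ = common-neighbour⇒same-side (Edge-sym y₂z₂) xy₂
        y₁≡y₂-if-adjacent-to : ∀ {z} → z ≢ x → Edge G y₁ z → Edge G y₂ z → y₁ ≡ y₂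
        y₁≡y₂-if-adjacent-to z≢x y₁z y₂z = common-neighbour-unique (z≢x ∘ sym) xy₁ (Edge-sym y₁z) xy₂ (Edge-sym y₂z)
        z₁≢z₂ : z₁ ≢ z₂
        z₁≢z₂ refl = y₁≢y₂ (y₁≡y₂-if-adjacent-to z₁≢x y₁z₁ y₂z₂)
        w,edges : ∃[ w ] (Edge G z₁ w × Edge G z₂ w)
        w,edges = common-neighbour z₁≢z₂ (trans sz₁ (sym sz₂))
        w = proj₁ w,edges
        z₁w = proj₁ (proj₂ w,edges)
        z₂w = proj₂ (proj₂ w,edges)
        sw : side w ≡ not s
        sw = trans (edge⇒side-flips z₁w) (cong not sz₁)
        y₁≢w : y₁ ≢ w
        y₁≢w y₁≡w = y₁≢y₂ (y₁≡y₂-if-adjacent-to z₂≢x (Edge-sym (subst (Edge G z₂) (sym y₁≡w) z₂w)) y₂z₂)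
        y₂≢w : y₂ ≢ w
        y₂≢w y₂≡w = y₁≢y₂ (y₁≡y₂-if-adjacent-to z₁≢x y₁z₁ (Edge-sym (subst (Edge G z₁) (sym y₂≡w) z₁w)))
        walk : Vec (Vtx G) 6
        walk = x ∷ y₁ ∷ z₁ ∷ w ∷ z₂ ∷ y₂ ∷ []
        walk! : Unique walk
        walk! = (opposite-sides⇒≢ refl sy₁ ∷ z₁≢x ∘ sym ∷ opposite-sides⇒≢ refl sw ∷ z₂≢x ∘ sym
                   ∷ opposite-sides⇒≢ refl sy₂ ∷ [])
              ∷ (opposite-sides⇒≢ sz₁ sy₁ ∘ sym ∷ y₁≢w ∷ opposite-sides⇒≢ sz₂ sy₁ ∘ sym ∷ y₁≢y₂ ∷ [])
              ∷ (opposite-sides⇒≢ sz₁ sw ∷ z₁≢z₂ ∷ opposite-sides⇒≢ sz₁ sy₂ ∷ [])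
              ∷ (opposite-sides⇒≢ sz₂ sw ∘ sym ∷ y₂≢w ∘ sym ∷ [])
              ∷ (opposite-sides⇒≢ sz₂ sy₂ ∷ [])
              ∷ [] ∷ []
        step : ∀ i → Edge G (lookup walk (Fin.inject₁ i)) (lookup walk (fsuc i))
        step fzero                                  = xy₁
        step (fsuc fzero)                           = y₁z₁
        step (fsuc (fsuc fzero))                    = z₁w
        step (fsuc (fsuc (fsuc fzero)))             = Edge-sym z₂w
        step (fsuc (fsuc (fsuc (fsuc fzero))))      = Edge-sym y₂z₂

      hexagon : Vtx G → HasCycle G 6
      hexagon x with another-neighbour (nbr₃ x (# 0)) x | another-neighbour (nbr₃ x (# 1)) x
      ... | _ , y₁z₁ , z₁≢x | _ , y₂z₂ , z₂≢x =
        hexagon-through (nbr₃-distinct x (λ ())) (nbr-edge x _) (nbr-edge x _) y₁z₁ y₂z₂ z₁≢x z₂≢x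

    no-triangle : ¬ HasCycle G 3
    no-triangle (_ , c , _ , E) = Boolₚ.not-¬ refl (begin
      side (c (# 0)) ≡⟨ edge⇒side-flips (E (# 2) (# 0) (inj₂ (refl , refl))) ⟩
      not (side (c (# 2))) ≡⟨ cong not (two-steps (E (# 0) (# 1) (inj₁ refl)) (E (# 1) (# 2) (inj₁ refl))) ⟩
      not (side (c (# 0))) ∎)
      where open ≡-Reasoning

    no-pentagon : ¬ HasCycle G 5
    no-pentagon (_ , c , _ , E) = Boolₚ.not-¬ refl (begin
      side (c (# 0)) ≡⟨ edge⇒side-flips (E (# 4) (# 0) (inj₂ (refl , refl))) ⟩
      not (side (c (# 4))) ≡⟨ cong not (two-steps (E (# 2) (# 3) (inj₁ refl)) (E (# 3) (# 4) (inj₁ refl))) ⟩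
      not (side (c (# 2))) ≡⟨ cong not (two-steps (E (# 0) (# 1) (inj₁ refl)) (E (# 1) (# 2) (inj₁ refl))) ⟩
      not (side (c (# 0))) ∎)
      where open ≡-Reasoning

    no-square : ¬ HasCycle G 4
    no-square (_ , c , c-injective , E) = 1≢3 (c-injective c₁≡c₃)
      where
      1≢3 : # 1 ≢ # 3
      1≢3 ()
      c₁≡c₃ : c (# 1) ≡ c (# 3)
      c₁≡c₃ = common-neighbour-unique ((λ ()) ∘ c-injective {# 0} {# 2})
        (E (# 0) (# 1) (inj₁ refl)) (Edge-sym (E (# 1) (# 2) (inj₁ refl)))
        (Edge-sym (E (# 3) (# 0) (inj₂ (refl , refl)))) (E (# 2) (# 3) (inj₁ refl))

    girth-6 : 2 ≤ q → Vtx G → Girth G 6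
    girth-6 2≤q x = hexagon 2≤q x , short
      where
      short : ∀ k → k < 6 → ¬ HasCycle G k
      short 3 _ = no-triangle
      short 4 _ = no-square
      short 5 _ = no-pentagon
      short (suc (suc (suc (suc (suc (suc _)))))) (s≤s (s≤s (s≤s (s≤s (s≤s (s≤s ())))))) _
      short 0 _ (() , _)
      short 1 _ (s≤s () , _)
      short 2 _ (s≤s (s≤s ()) , _)

open ProjectivePlaneGraphs

module Subdivisions where

  open import Data.Nat using (ℕ; zero; suc; z≤n; s≤s)
  open import Data.Fin using (Fin; toℕ; punchIn; inject₁; fromℕ) renaming (zero to fzero; suc to fsuc; _<_ to _<ᶠ_)
  import Data.Fin.Properties as Finₚ
  open import Data.Product using (∃-syntax; Σ-syntax; _×_; _,_; proj₁; proj₂)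
  open import Data.Sum using (_⊎_; inj₁; inj₂)
  open import Data.Empty using (⊥-elim)
  open import Function using (_∘_)
  open import Function.Definitions using (Injective)
  open import Relation.Unary using (_∩_)
  open import Relation.Nullary using (yes; no; contradiction)
  open import Relation.Binary.Definitions using (tri<; tri≈; tri>)
  open import Relation.Binary.PropositionalEquality using (_≡_; _≢_; refl; sym; trans; cong; subst; module ≡-Reasoning)
  open import Axiom.UniquenessOfIdentityProofs.WithK using (uip)

  nat-neighbours≤2 : ∀ a → AtMostTwo (λ b → suc a ≡ b ⊎ suc b ≡ a)
  nat-neighbours≤2 a b≢c b≢d c≢d (inj₁ refl) (inj₁ refl) _           = b≢c refl
  nat-neighbours≤2 a b≢c b≢d c≢d (inj₁ refl) (inj₂ _)    (inj₁ refl)  = b≢d refl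
  nat-neighbours≤2 a b≢c b≢d c≢d (inj₁ refl) (inj₂ c+1)  (inj₂ d+1)   = c≢d (ℕₚ.suc-injective (trans c+1 (sym d+1)))
  nat-neighbours≤2 a b≢c b≢d c≢d (inj₂ b+1)  (inj₁ refl) (inj₁ refl)  = c≢d refl
  nat-neighbours≤2 a b≢c b≢d c≢d (inj₂ b+1)  (inj₁ refl) (inj₂ d+1)   = b≢d (ℕₚ.suc-injective (trans b+1 (sym d+1)))
  nat-neighbours≤2 a b≢c b≢d c≢d (inj₂ b+1)  (inj₂ c+1)  _            = b≢c (ℕₚ.suc-injective (trans b+1 (sym c+1)))

  record ConsecutiveOn {G : Graph} (P : Path G) (x y : Vtx G) : Set where
    field
      pos-x    : Fin (suc (suc (L P)))
      pos-y    : Fin (suc (suc (L P)))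
      at-x     : p P pos-x ≡ x
      at-y     : p P pos-y ≡ y
      adjacent : suc (toℕ pos-x) ≡ toℕ pos-y ⊎ suc (toℕ pos-y) ≡ toℕ pos-x

  consecutive≤2 : ∀ {G} (P : Path G) x → AtMostTwo (ConsecutiveOn P x)
  consecutive≤2 P x y₁≢y₂ y₁≢y₃ y₂≢y₃ c₁ c₂ c₃ =
    nat-neighbours≤2 (toℕ (pos-x c₁)) (apart y₁≢y₂ c₁ c₂) (apart y₁≢y₃ c₁ c₃) (apart y₂≢y₃ c₂ c₃)
      (adjacent c₁) (realign c₂) (realign c₃)
    where
    open ConsecutiveOn
    realign : ∀ {y} (c : ConsecutiveOn P x y) →
      suc (toℕ (pos-x c₁)) ≡ toℕ (pos-y c) ⊎ suc (toℕ (pos-y c)) ≡ toℕ (pos-x c₁)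
    realign c = subst (λ a → suc (toℕ a) ≡ toℕ (pos-y c) ⊎ suc (toℕ (pos-y c)) ≡ toℕ a)
      (inj P (trans (at-x c) (sym (at-x c₁)))) (adjacent c)
    apart : ∀ {y y′} → y ≢ y′ → (c : ConsecutiveOn P x y) (c′ : ConsecutiveOn P x y′) → toℕ (pos-y c) ≢ toℕ (pos-y c′)
    apart y≢y′ c c′ eq = y≢y′ (trans (sym (at-y c)) (trans (cong (p P) (Finₚ.toℕ-injective eq)) (at-y c′)))

  last-or-inject₁ : ∀ {k} (a : Fin (suc k)) → a ≡ fromℕ k ⊎ ∃[ j ] a ≡ inject₁ j
  last-or-inject₁ {zero}  fzero    = inj₁ refl
  last-or-inject₁ {suc k} fzero    = inj₂ (fzero , refl)
  last-or-inject₁ {suc k} (fsuc a) with last-or-inject₁ a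
  ... | inj₁ refl       = inj₁ refl
  ... | inj₂ (j , refl) = inj₂ (fsuc j , refl)

  module _ {G : Graph} (P : Path G) where

    open GraphProperties G

    internal-neighbours : ∀ j → ∃[ y ] ∃[ y′ ] (Edge G (internal P j) y × Edge G (internal P j) y′ × y ≢ y′)
    internal-neighbours j = p P (inject₁ (inject₁ j)) , p P (fsuc (fsuc j)) ,
      Edge-sym (consec P (inject₁ j)) , consec P (fsuc j) , apart
      where
      apart : p P (inject₁ (inject₁ j)) ≢ p P (fsuc (fsuc j))
      apart eq = ℕₚ.<⇒≢ (ℕₚ.m<n+m (toℕ j) (s≤s z≤n)) (begin
        toℕ j                     ≡⟨ sym (Finₚ.toℕ-inject₁ j) ⟩
        toℕ (inject₁ j)           ≡⟨ sym (Finₚ.toℕ-inject₁ (inject₁ j)) ⟩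
        toℕ (inject₁ (inject₁ j)) ≡⟨ cong toℕ (inj P eq) ⟩
        suc (suc (toℕ j))         ∎)
        where open ≡-Reasoning

    first-step-of-path : ∃[ y ] (Edge G (start P) y × (y ≡ end P ⊎ ∃[ j ] internal P j ≡ y))
    first-step-of-path with L P | p P | consec P
    ... | zero  | q | c = q (fsuc fzero) , c fzero , inj₁ refl
    ... | suc _ | q | c = q (fsuc fzero) , c fzero , inj₂ (fzero , refl)

    last-step-of-path : ∃[ y ] (Edge G (end P) y × (y ≡ start P ⊎ ∃[ j ] internal P j ≡ y))
    last-step-of-path with L P | p P | consec P
    ... | zero  | q | c = q fzero , Edge-sym (c fzero) , inj₁ refl
    ... | suc k | q | c = q (inject₁ (fromℕ (suc k))) , Edge-sym (c (fromℕ (suc k))) , inj₂ (fromℕ k , refl)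

  module SubdivisionProperties {S H : Graph} (sd : IsSubdivisionOf S H) where

    open IsSubdivisionOf sd
    module H = GraphProperties H

    NonBranch : Vtx S → Set
    NonBranch x = ∀ w → branch w ≢ x

    PathIndex : Set
    PathIndex = Σ[ u ∈ Vtx H ] Σ[ v ∈ Vtx H ] (u <ᶠ v × Edge H u v)

    pathAt : PathIndex → Path S
    pathAt (u , v , u<v , e) = path u v u<v e

    Internal : PathIndex → Vtx S → Set
    Internal i x = ∃[ j ] internal (pathAt i) j ≡ x

    internal-ends : ∀ {i i′ x} → Internal i x → Internal i′ x → proj₁ i ≡ proj₁ i′ × proj₁ (proj₂ i) ≡ proj₁ (proj₂ i′)
    internal-ends {u , v , u<v , e} {u′ , v′ , u′<v′ , e′} (j , at-j) (j′ , at-j′) =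
      internal-disjoint u v u<v e u′ v′ u′<v′ e′ j j′ (trans at-j (sym at-j′))

    same-path : ∀ {i i′ x} → Internal i x → Internal i′ x → pathAt i ≡ pathAt i′
    same-path {_ , _ , u<v , e} {_ , _ , u′<v′ , e′} int int′ with internal-ends int int′
    ... | refl , refl rewrite Finₚ.<-irrelevant u<v u′<v′ | uip e e′ = refl

    edge-on-path : ∀ {x y} → Edge S x y → ∃[ i ] ConsecutiveOn (pathAt i) x y
    edge-on-path {x} {y} e with edges-on-paths x y e
    ... | u , v , u<v , uv , k , inj₁ (at-x , at-y) = (u , v , u<v , uv) , record
      { pos-x = inject₁ k ; pos-y = fsuc k ; at-x = at-x ; at-y = at-y ; adjacent = inj₁ (cong suc (Finₚ.toℕ-inject₁ k)) }
    ... | u , v , u<v , uv , k , inj₂ (at-y , at-x) = (u , v , u<v , uv) , record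
      { pos-x = fsuc k ; pos-y = inject₁ k ; at-x = at-x ; at-y = at-y ; adjacent = inj₂ (cong suc (Finₚ.toℕ-inject₁ k)) }

    nonbranch⇒internal : ∀ {i x y} → NonBranch x → ConsecutiveOn (pathAt i) x y → Internal i x
    nonbranch⇒internal {u , v , u<v , e} nb c with ConsecutiveOn.pos-x c | ConsecutiveOn.at-x c
    ... | fzero  | at-x = ⊥-elim (nb u (trans (sym (path-start u v u<v e)) at-x))
    ... | fsuc a | at-x with last-or-inject₁ a
    ...   | inj₁ refl       = ⊥-elim (nb v (trans (sym (path-end u v u<v e)) at-x))
    ...   | inj₂ (j , refl) = j , at-x

    nonbranch-degree≤2 : ∀ {x} → NonBranch x → AtMostTwo (Edge S x)
    nonbranch-degree≤2 {x} nb y₁≢y₂ y₁≢y₃ y₂≢y₃ xy₁ xy₂ xy₃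
      with edge-on-path xy₁ | edge-on-path xy₂ | edge-on-path xy₃
    ... | i₁ , c₁ | i₂ , c₂ | i₃ , c₃ = consecutive≤2 (pathAt i₁) x y₁≢y₂ y₁≢y₃ y₂≢y₃ c₁
      (subst (λ P → ConsecutiveOn P x _) (same-path (internal-of c₂) (internal-of c₁)) c₂)
      (subst (λ P → ConsecutiveOn P x _) (same-path (internal-of c₃) (internal-of c₁)) c₃)
      where
      internal-of : ∀ {i y} → ConsecutiveOn (pathAt i) x y → Internal i x
      internal-of = nonbranch⇒internal nb

    nonbranch-another-neighbour : ∀ {x} → NonBranch x → ∀ y → ∃[ y′ ] (Edge S x y′ × y′ ≢ y)
    nonbranch-another-neighbour {x} nb y with covers x
    ... | inj₁ (w , at-w) = ⊥-elim (nb w at-w)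
    ... | inj₂ (u , v , u<v , e , j , refl) with internal-neighbours (path u v u<v e) j
    ...   | y₁ , y₂ , xy₁ , xy₂ , y₁≢y₂ with y₁ Finₚ.≟ y
    ...     | yes refl = y₂ , xy₂ , y₁≢y₂ ∘ sym
    ...     | no  y₁≢y = y₁ , xy₁ , y₁≢y

    Joins : PathIndex → Vtx H → Vtx H → Set
    Joins (a , b , _) u v = (a ≡ u × b ≡ v) ⊎ (a ≡ v × b ≡ u)

    Towards : Vtx H → Vtx H → Vtx S → Set
    Towards u v y = y ≡ branch v ⊎ Σ[ i ∈ PathIndex ] (Joins i u v × Internal i y)

    first-step : ∀ u v → u ≢ v → Edge H u v → ∃[ y ] (Edge S (branch u) y × Towards u v y)
    first-step u v u≢v e with Finₚ.<-cmp u v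
    ... | tri≈ _ u≡v _ = ⊥-elim (u≢v u≡v)
    ... | tri< u<v _ _ with first-step-of-path (path u v u<v e)
    ...   | y , uy , inj₁ y≡end = y , subst (λ z → Edge S z y) (path-start u v u<v e) uy ,
                                   inj₁ (trans y≡end (path-end u v u<v e))
    ...   | y , uy , inj₂ int   = y , subst (λ z → Edge S z y) (path-start u v u<v e) uy ,
                                   inj₂ ((u , v , u<v , e) , inj₁ (refl , refl) , int)
    first-step u v u≢v e | tri> _ _ v<u with last-step-of-path (path v u v<u (H.Edge-sym e))
    ...   | y , uy , inj₁ y≡start = y , subst (λ z → Edge S z y) (path-end v u v<u _) uy ,
                                     inj₁ (trans y≡start (path-start v u v<u _))
    ...   | y , uy , inj₂ int     = y , subst (λ z → Edge S z y) (path-end v u v<u _) uy ,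
                                     inj₂ ((v , u , v<u , H.Edge-sym e) , inj₂ (refl , refl) , int)

    Towards-unique : ∀ {u v w y} → u ≢ v → u ≢ w → Towards u v y → Towards u w y → v ≡ w
    Towards-unique _ _ (inj₁ y≡v) (inj₁ y≡w) = branch-inj (trans (sym y≡v) y≡w)
    Towards-unique _ _ (inj₁ y≡v) (inj₂ ((a , b , a<b , e) , _ , j , at-j)) =
      ⊥-elim (internal-not-branch a b a<b e j _ (trans at-j y≡v))
    Towards-unique _ _ (inj₂ ((a , b , a<b , e) , _ , j , at-j)) (inj₁ y≡w) =
      ⊥-elim (internal-not-branch a b a<b e j _ (trans at-j y≡w))
    Towards-unique u≢v u≢w (inj₂ (i , joins , int)) (inj₂ (i′ , joins′ , int′))
      with internal-ends int int′
    ... | refl , refl with joins | joins′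
    ...   | inj₁ (refl , refl) | inj₁ (refl , refl) = refl
    ...   | inj₁ (refl , refl) | inj₂ (a≡w , _)     = ⊥-elim (u≢w a≡w)
    ...   | inj₂ (a≡v , _)     | inj₁ (refl , refl) = ⊥-elim (u≢v a≡v)
    ...   | inj₂ (refl , _)    | inj₂ (refl , _)    = refl

  complete-edge : ∀ {m} (u v : Fin m) → u ≢ v → Edge (complete m) u v
  complete-edge u v u≢v with u Finₚ.≟ v
  ... | yes u≡v = contradiction u≡v u≢v
  ... | no  _   = refl

  module CompleteSubdivisionProperties {S : Graph} {d : ℕ} (sd : IsSubdivisionOf S (complete (suc d))) where

    open IsSubdivisionOf sd
    open SubdivisionProperties sd

    private
      u≢punchIn : ∀ (u : Fin (suc d)) i → u ≢ punchIn u i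
      u≢punchIn u i = Finₚ.punchInᵢ≢i u i ∘ sym

      step-towards : ∀ (u : Fin (suc d)) i → ∃[ y ] (Edge S (branch u) y × Towards u (punchIn u i) y)
      step-towards u i = first-step u (punchIn u i) (u≢punchIn u i) (complete-edge u (punchIn u i) (u≢punchIn u i))

    towards : Fin (suc d) → Fin d → Vtx S
    towards u i = proj₁ (step-towards u i)

    towards-edge : ∀ (u : Fin (suc d)) i → Edge S (branch u) (towards u i)
    towards-edge u i = proj₁ (proj₂ (step-towards u i))

    towards-injective : ∀ (u : Fin (suc d)) → Injective _≡_ _≡_ (towards u)
    towards-injective u {i} {j} eq = Finₚ.punchIn-injective u i j (Towards-unique (u≢punchIn u i) (u≢punchIn u j)
      (proj₂ (proj₂ (step-towards u i)))
      (subst (Towards u (punchIn u j)) (sym eq) (proj₂ (proj₂ (step-towards u j)))))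

  -- The vertex set H of an induced subdivision of K_m in G, through the degree conditions that the argument uses.
  record InducedSubdivisionProfile (G : Graph) (m : ℕ) : Set₁ where
    field
      branch           : Fin m → Vtx G
      branch-injective : Injective _≡_ _≡_ branch
      InH              : Vtx G → Set
      branch∈H         : ∀ u → InH (branch u)
      branch-nbr∈H     : ∀ u {y} → Edge G (branch u) y → InH y
      nonbranch-degree≤2 : ∀ {x} → InH x → (∀ u → branch u ≢ x) → AtMostTwo (InH ∩ Edge G x)
      nonbranch-another-neighbour : ∀ {x} → InH x → (∀ u → branch u ≢ x) → ∀ y →
        ∃[ y′ ] (InH y′ × Edge G x y′ × y′ ≢ y)

  induced-subdivision-profile : ∀ {G d} → NeighbourEnumeration G d →
    ContainsInducedSubdivision G (complete (suc d)) → InducedSubdivisionProfile G (suc d)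
  induced-subdivision-profile {G} {d} E (S , sd , f , f-injective , f-adj) = record
    { branch             = f ∘ branch
    ; branch-injective   = branch-inj ∘ f-injective
    ; InH                = InH
    ; branch∈H           = λ u → branch u , refl
    ; branch-nbr∈H       = branch-nbr∈H
    ; nonbranch-degree≤2 = degree≤2
    ; nonbranch-another-neighbour = another-neighbour
    }
    where
    open IsSubdivisionOf sd
    open SubdivisionProperties sd
    open CompleteSubdivisionProperties sd

    InH : Vtx G → Set
    InH y = ∃[ s ] f s ≡ y

    Edge⇒ : ∀ {s t} → Edge S s t → Edge G (f s) (f t)
    Edge⇒ {s} {t} = trans (f-adj s t)

    Edge⇐ : ∀ {s t} → Edge G (f s) (f t) → Edge S s t
    Edge⇐ {s} {t} = trans (sym (f-adj s t))

    nonbranch⇐ : ∀ {s} → (∀ u → f (branch u) ≢ f s) → NonBranch s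
    nonbranch⇐ nb u = nb u ∘ cong f

    branch-nbr∈H : ∀ u {y} → Edge G (f (branch u)) y → InH y
    branch-nbr∈H u e with neighbours-saturated E (f ∘ towards u) (towards-injective u ∘ f-injective)
                            (Edge⇒ ∘ towards-edge u) e
    ... | i , at-i = towards u i , at-i

    degree≤2 : ∀ {x} → InH x → (∀ u → f (branch u) ≢ x) → AtMostTwo (InH ∩ Edge G x)
    degree≤2 (s , refl) nb y₁≢y₂ y₁≢y₃ y₂≢y₃ ((s₁ , refl) , e₁) ((s₂ , refl) , e₂) ((s₃ , refl) , e₃) =
      nonbranch-degree≤2 (nonbranch⇐ nb) (y₁≢y₂ ∘ cong f) (y₁≢y₃ ∘ cong f) (y₂≢y₃ ∘ cong f)
        (Edge⇐ e₁) (Edge⇐ e₂) (Edge⇐ e₃)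

    another-neighbour : ∀ {x} → InH x → (∀ u → f (branch u) ≢ x) → ∀ y → ∃[ y′ ] (InH y′ × Edge G x y′ × y′ ≢ y)
    another-neighbour (s , refl) nb y with Finₚ.any? (λ t → f t Finₚ.≟ y)
    ... | yes (t , refl) with nonbranch-another-neighbour (nonbranch⇐ nb) t
    ...   | t′ , st′ , t′≢t = f t′ , (t′ , refl) , Edge⇒ st′ , t′≢t ∘ f-injective
    another-neighbour (s , refl) nb y | no y∉f with nonbranch-another-neighbour (nonbranch⇐ nb) s
    ...   | t′ , st′ , _ = f t′ , (t′ , refl) , Edge⇒ st′ , λ f-t′≡y → y∉f (t′ , f-t′≡y)

open Subdivisions

module NoInducedSubdivision {G : Graph} {q : ℕ} (PG : ProjectivePlaneGraph G q)
  (H : InducedSubdivisionProfile G (suc (suc q))) (5≤q : 5 ≤ q) where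

  open import Data.Nat using (ℕ; suc; _≤_; z≤n; s≤s)
  open import Data.Fin using (Fin; punchIn; #_) renaming (zero to fzero)
  import Data.Fin.Properties as Finₚ
  open import Data.Bool using (not)
  import Data.Bool.Properties as Boolₚ
  open import Data.Vec using (Vec; _∷_; tabulate)
  open import Data.Vec.Relation.Unary.All using (All; _∷_)
  import Data.Vec.Relation.Unary.All.Properties as Allₚ
  open import Data.Vec.Relation.Unary.Unique.Propositional using (Unique; _∷_)
  import Data.Vec.Relation.Unary.Unique.Propositional.Properties as Uniqueₚ
  open import Data.Product using (∃-syntax; _×_; _,_; proj₁; proj₂)
  open import Data.Sum using (_⊎_; inj₁; inj₂)
  open import Data.Empty using (⊥; ⊥-elim)
  open import Function using (_∘_)
  open import Function.Definitions using (Injective)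
  open import Relation.Unary using (Pred; Decidable; _∩_)
  open import Relation.Nullary using (¬_; Dec; yes; no)
  open import Relation.Nullary.Decidable using (_×-dec_; ¬?; decidable-stable)
  open import Relation.Binary.PropositionalEquality using (_≡_; _≢_; refl; sym; trans; cong; subst; module ≡-Reasoning)

  open GraphProperties G
  open ProjectivePlaneGraphProperties PG
  open InducedSubdivisionProfile H

  2≤q : 2 ≤ q
  2≤q = ℕₚ.≤-trans (s≤s (s≤s z≤n)) 5≤q

  Branch : Pred (Vtx G) _
  Branch x = ∃[ u ] branch u ≡ x

  branch? : Decidable Branch
  branch? x = Finₚ.any? (λ u → branch u Finₚ.≟ x)

  OppositeBranch : Vtx G → Pred (Vtx G) _
  OppositeBranch r x = Branch x × side x ≡ not (side r)

  Lonely : Vtx G → Set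
  Lonely r = ∀ {x} → Branch x → side x ≡ side r → x ≡ r

  Branch⇒InH : ∀ {x} → Branch x → InH x
  Branch⇒InH (u , refl) = branch∈H u

  neighbour-of-branch∈H : ∀ {x y} → Branch x → Edge G x y → InH y
  neighbour-of-branch∈H (u , refl) = branch-nbr∈H u

  ¬branch-degree≤2 : ∀ {x} → InH x → ¬ Branch x → AtMostTwo (InH ∩ Edge G x)
  ¬branch-degree≤2 x∈H ¬branch = nonbranch-degree≤2 x∈H (λ u eq → ¬branch (u , eq))

  opposite-sides : ∀ {x y} → side y ≡ not (side x) → side x ≡ not (side y)
  opposite-sides {x} sy = trans (sym (Boolₚ.not-involutive (side x))) (cong not (sym sy))

  branches≤ : ∀ {k} (xs : Vec (Vtx G) k) → Unique xs → All Branch xs → k ≤ suc (suc q)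
  branches≤ xs xs! xs-branch = Finₚ.injective⇒≤ {f = index} index-injective
    where
    index : _ → _
    index i = proj₁ (Allₚ.lookup⁺ xs-branch i)
    index-injective : Injective _≡_ _≡_ index
    index-injective {i} {j} eq = Uniqueₚ.lookup-injective xs! i j (trans (sym (proj₂ (Allₚ.lookup⁺ xs-branch i)))
      (trans (cong branch eq) (proj₂ (Allₚ.lookup⁺ xs-branch j))))

  -- With m joining l₁, l₂ and t₀ joining r, m, a non-branch neighbour t ≠ t₀ of r would have the three
  -- H-neighbours r, w₁, w₂; so r, l₁, l₂ and the q other neighbours of r are q + 3 branch vertices.
  module FarNonNeighbours {r l₁ l₂} (r-branch : Branch r) (l₁≢l₂ : l₁ ≢ l₂)
    (l₁-opp : OppositeBranch r l₁) (l₂-opp : OppositeBranch r l₂) (r≁l₁ : ¬ Edge G r l₁) (r≁l₂ : ¬ Edge G r l₂) where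

    m-edges : ∃[ m ] (Edge G l₁ m × Edge G l₂ m)
    m-edges = common-neighbour l₁≢l₂ (trans (proj₂ l₁-opp) (sym (proj₂ l₂-opp)))

    m = proj₁ m-edges
    l₁m = proj₁ (proj₂ m-edges)
    l₂m = proj₂ (proj₂ m-edges)

    r≢m : r ≢ m
    r≢m r≡m = r≁l₁ (Edge-sym (subst (Edge G l₁) (sym r≡m) l₁m))

    t₀-edges : ∃[ t₀ ] (Edge G r t₀ × Edge G m t₀)
    t₀-edges = common-neighbour r≢m (trans (opposite-sides (proj₂ l₁-opp)) (sym (edge⇒side-flips l₁m)))

    t₀ = proj₁ t₀-edges
    rt₀ = proj₁ (proj₂ t₀-edges)
    mt₀ = proj₂ (proj₂ t₀-edges)

    module _ {t} (rt : Edge G r t) (¬bt : ¬ Branch t) where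

      meet : ∀ {l} → OppositeBranch r l → ¬ Edge G r l → ∃[ w ] (Edge G l w × Edge G t w)
      meet (_ , sl) r≁l = common-neighbour (λ l≡t → r≁l (subst (Edge G r) (sym l≡t) rt))
        (trans sl (sym (edge⇒side-flips rt)))

      w₁ = proj₁ (meet l₁-opp r≁l₁)
      w₂ = proj₁ (meet l₂-opp r≁l₂)
      l₁w₁ = proj₁ (proj₂ (meet l₁-opp r≁l₁))
      l₂w₂ = proj₁ (proj₂ (meet l₂-opp r≁l₂))
      tw₁ = proj₂ (proj₂ (meet l₁-opp r≁l₁))
      tw₂ = proj₂ (proj₂ (meet l₂-opp r≁l₂))

      r≢w : ∀ {l w} → ¬ Edge G r l → Edge G l w → r ≢ w
      r≢w r≁l lw r≡w = r≁l (Edge-sym (subst (Edge G _) (sym r≡w) lw))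

      nonbranch-neighbour≡t₀ : t ≡ t₀
      nonbranch-neighbour≡t₀ with w₁ Finₚ.≟ w₂
      ... | yes w₁≡w₂ = common-neighbour-unique r≢m rt (Edge-sym (subst (Edge G t) w₁≡m tw₁)) rt₀ mt₀
        where
        w₁≡m : w₁ ≡ m
        w₁≡m = common-neighbour-unique l₁≢l₂ l₁w₁ (subst (Edge G l₂) (sym w₁≡w₂) l₂w₂) l₁m l₂m
      ... | no w₁≢w₂ = ⊥-elim (¬branch-degree≤2 (neighbour-of-branch∈H r-branch rt) ¬bt
        (r≢w r≁l₁ l₁w₁) (r≢w r≁l₂ l₂w₂) w₁≢w₂ (Branch⇒InH r-branch , Edge-sym rt)
        (neighbour-of-branch∈H (proj₁ l₁-opp) l₁w₁ , tw₁) (neighbour-of-branch∈H (proj₁ l₂-opp) l₂w₂ , tw₂))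

    i₀ = proj₁ (nbr-surjective rt₀)

    others : Fin q → Vtx G
    others j = nbr r (punchIn i₀ j)

    others-branch : ∀ j → Branch (others j)
    others-branch j with branch? (others j)
    ... | yes b = b
    ... | no ¬b = ⊥-elim (Finₚ.punchInᵢ≢i i₀ j (nbr-injective r
      (trans (nonbranch-neighbour≡t₀ (nbr-edge r _) ¬b) (sym (proj₂ (nbr-surjective rt₀))))))

    l≢others : ∀ {l} → ¬ Edge G r l → ∀ j → l ≢ others j
    l≢others r≁l j l≡ = r≁l (subst (Edge G r) (sym l≡) (nbr-edge r _))

    impossible : ⊥
    impossible = ℕₚ.1+n≰n (branches≤ (r ∷ l₁ ∷ l₂ ∷ tabulate others) distinct
      (r-branch ∷ proj₁ l₁-opp ∷ proj₁ l₂-opp ∷ Allₚ.tabulate⁺ others-branch))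
      where
      distinct : Unique (r ∷ l₁ ∷ l₂ ∷ tabulate others)
      distinct = (opposite-sides⇒≢ refl (proj₂ l₁-opp) ∷ opposite-sides⇒≢ refl (proj₂ l₂-opp)
                    ∷ Allₚ.tabulate⁺ (λ _ → Edge⇒≢ (nbr-edge r _)))
               ∷ (l₁≢l₂ ∷ Allₚ.tabulate⁺ (l≢others r≁l₁))
               ∷ Allₚ.tabulate⁺ (l≢others r≁l₂)
               ∷ Uniqueₚ.tabulate⁺ (Finₚ.punchIn-injective i₀ _ _ ∘ nbr-injective r)

  far-nonneighbours≤1 : ∀ {r} → Branch r → AtMostOne (OppositeBranch r ∩ (¬_ ∘ Edge G r))
  far-nonneighbours≤1 r-branch l₁≢l₂ (l₁-opp , r≁l₁) (l₂-opp , r≁l₂) =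
    FarNonNeighbours.impossible r-branch l₁≢l₂ l₁-opp l₂-opp r≁l₁ r≁l₂

  far-branch-adjacent : ∀ {r l x} → Branch r → OppositeBranch r l → ¬ Edge G r l → OppositeBranch r x → x ≢ l → Edge G r x
  far-branch-adjacent {r} {l} {x} r-branch l-opp r≁l x-opp x≢l with Edge? r x
  ... | yes rx  = rx
  ... | no  r≁x = ⊥-elim (far-nonneighbours≤1 r-branch x≢l (x-opp , r≁x) (l-opp , r≁l))

  module PrivateNeighbour {r t₁ z} (r-branch : Branch r) (t₁-branch : Branch t₁) (rt₁ : Edge G r t₁)
    (t₁z : Edge G t₁ z) (z≢r : z ≢ r) (¬bz : ¬ Branch z) (private-z : ∀ {y} → Branch y → Edge G z y → y ≡ t₁) where

    z∈H : InH z
    z∈H = neighbour-of-branch∈H t₁-branch t₁z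

    s-edges : ∃[ s ] (InH s × Edge G z s × s ≢ t₁)
    s-edges = nonbranch-another-neighbour z∈H (λ u eq → ¬bz (u , eq)) t₁

    s = proj₁ s-edges
    s∈H = proj₁ (proj₂ s-edges)
    zs = proj₁ (proj₂ (proj₂ s-edges))
    s≢t₁ = proj₂ (proj₂ (proj₂ s-edges))

    ¬bs : ¬ Branch s
    ¬bs bs = s≢t₁ (private-z bs zs)

    zt₁ : Edge G z t₁
    zt₁ = Edge-sym t₁z

    ≡t₁-if-adjacent-to-z : ∀ {t} → Edge G r t → Edge G z t → t ≡ t₁
    ≡t₁-if-adjacent-to-z rt zt = common-neighbour-unique (z≢r ∘ sym) rt zt rt₁ zt₁

    meet : ∀ {t} → Branch t → Edge G r t → t ≢ t₁ → ∃[ a ] (Edge G s a × Edge G t a)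
    meet bt rt t≢t₁ = common-neighbour (λ s≡t → t≢t₁ (private-z bt (subst (Edge G z) s≡t zs))) (begin
      side s        ≡⟨ edge⇒side-flips zs ⟩
      not (side z)  ≡⟨ cong not (common-neighbour⇒same-side zt₁ rt₁) ⟩
      not (side r)  ≡⟨ sym (edge⇒side-flips rt) ⟩
      side _        ∎)
      where open ≡-Reasoning

    z≢a : ∀ {t a} → Edge G r t → t ≢ t₁ → Edge G t a → z ≢ a
    z≢a rt t≢t₁ ta z≡a = t≢t₁ (≡t₁-if-adjacent-to-z rt (Edge-sym (subst (Edge G _) (sym z≡a) ta)))

    -- The second H-neighbour s of z is no branch vertex, yet it is adjacent to z, a₂ and a₃ (aᵢ joins s to tᵢ).
    other-branch-neighbours≤1 : AtMostOne (λ t → Branch t × Edge G r t × t ≢ t₁)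
    other-branch-neighbours≤1 {t₂} {t₃} t₂≢t₃ (b₂ , rt₂ , t₂≢t₁) (b₃ , rt₃ , t₃≢t₁) =
      ¬branch-degree≤2 s∈H ¬bs (z≢a rt₂ t₂≢t₁ t₂a₂) (z≢a rt₃ t₃≢t₁ t₃a₃) a₂≢a₃
        (z∈H , Edge-sym zs) (neighbour-of-branch∈H b₂ t₂a₂ , sa₂) (neighbour-of-branch∈H b₃ t₃a₃ , sa₃)
      where
      a₂ = proj₁ (meet b₂ rt₂ t₂≢t₁)
      sa₂ = proj₁ (proj₂ (meet b₂ rt₂ t₂≢t₁))
      t₂a₂ = proj₂ (proj₂ (meet b₂ rt₂ t₂≢t₁))
      a₃ = proj₁ (meet b₃ rt₃ t₃≢t₁)
      sa₃ = proj₁ (proj₂ (meet b₃ rt₃ t₃≢t₁))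
      t₃a₃ = proj₂ (proj₂ (meet b₃ rt₃ t₃≢t₁))
      a₂≢a₃ : a₂ ≢ a₃
      a₂≢a₃ a₂≡a₃ with a₂ Finₚ.≟ r
      ... | yes a₂≡r = s≢t₁ (≡t₁-if-adjacent-to-z (Edge-sym (subst (Edge G s) a₂≡r sa₂)) (zs))
      ... | no a₂≢r = t₂≢t₃ (common-neighbour-unique a₂≢r (Edge-sym t₂a₂) rt₂
                        (Edge-sym (subst (Edge G t₃) (sym a₂≡a₃) t₃a₃)) rt₃)

  -- A neighbour z of t₁ avoiding r and ex has t₁ as its only branch neighbour, so PrivateNeighbour applies.
  lonely-branch : ∀ {r ex} → Branch r → Lonely r → (∀ {x} → OppositeBranch r x → x ≢ ex → Edge G r x) →
    AtMostTwo (λ t → Branch t × Edge G r t × t ≢ ex)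
  lonely-branch {r} {ex} r-branch lonely r~far {t₁} t₁≢t₂ t₁≢t₃ t₂≢t₃ (b₁ , rt₁ , t₁≢ex) (b₂ , rt₂ , _) (b₃ , rt₃ , _)
    with neighbour-avoiding 2≤q t₁ r ex (t₁≢ex ∘ sym)
  ... | z , t₁z , z≢r , z≁ex = PrivateNeighbour.other-branch-neighbours≤1 r-branch b₁ rt₁ t₁z z≢r ¬bz private-z
    t₂≢t₃ (b₂ , rt₂ , t₁≢t₂ ∘ sym) (b₃ , rt₃ , t₁≢t₃ ∘ sym)
    where
    side-z : side z ≡ side r
    side-z = common-neighbour⇒same-side (Edge-sym t₁z) rt₁
    ¬bz : ¬ Branch z
    ¬bz bz = z≢r (lonely bz side-z)
    private-z : ∀ {y} → Branch y → Edge G z y → y ≡ t₁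
    private-z by zy = common-neighbour-unique (z≢r ∘ sym)
      (r~far (by , trans (edge⇒side-flips zy) (cong not side-z)) (λ y≡ex → z≁ex (subst (Edge G z) y≡ex zy))) zy
      rt₁ (Edge-sym t₁z)

  Companion : Vtx G → Set
  Companion r = ∃[ u ] (side (branch u) ≡ side r × branch u ≢ r)

  companion? : ∀ r → Dec (Companion r)
  companion? r = Finₚ.any? (λ u → (side (branch u) Boolₚ.≟ side r) ×-dec ¬? (branch u Finₚ.≟ r))

  ¬companion⇒lonely : ∀ {r} → ¬ Companion r → Lonely r
  ¬companion⇒lonely {r} none (u , refl) same = decidable-stable (branch u Finₚ.≟ r) (λ ≢r → none (u , same , ≢r))

  -- If another branch vertex w lies on r's side, every tᵢ is a non-neighbour of w (at most one of them, by
  -- far-nonneighbours≤1) or a common neighbour of r and w (at most one); otherwise r is lonely.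
  few-far-branches : ∀ {r l} → Branch r → OppositeBranch r l → ¬ Edge G r l → AtMostTwo (λ t → OppositeBranch r t × t ≢ l)
  few-far-branches {r} {l} r-branch l-opp r≁l {t₁} {t₂} {t₃} t₁≢t₂ t₁≢t₃ t₂≢t₃ (o₁ , t₁≢l) (o₂ , t₂≢l) (o₃ , t₃≢l)
    with companion? r
  ... | yes (u , same , w≢r) = atMostOne-∪ (far-nonneighbours≤1 (u , refl)) common-with-r≤1 t₁≢t₂ t₁≢t₃ t₂≢t₃
    (classify o₁ t₁≢l) (classify o₂ t₂≢l) (classify o₃ t₃≢l)
    where
    w = branch u
    common-with-r≤1 : AtMostOne (Edge G r ∩ Edge G w)
    common-with-r≤1 a≢b (ra , wa) (rb , wb) = a≢b (common-neighbour-unique (w≢r ∘ sym) ra wa rb wb)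
    classify : ∀ {t} → OppositeBranch r t → t ≢ l → (OppositeBranch w ∩ (¬_ ∘ Edge G w)) t ⊎ (Edge G r ∩ Edge G w) t
    classify {t} t-opp@(bt , st) t≢l with Edge? w t
    ... | yes wt  = inj₂ (far-branch-adjacent r-branch l-opp r≁l t-opp t≢l , wt)
    ... | no  w≁t = inj₁ ((bt , trans st (cong not (sym same))) , w≁t)
  ... | no none = lonely-branch r-branch (¬companion⇒lonely none) (far-branch-adjacent r-branch l-opp r≁l)
    t₁≢t₂ t₁≢t₃ t₂≢t₃ (branch-neighbour o₁ t₁≢l) (branch-neighbour o₂ t₂≢l) (branch-neighbour o₃ t₃≢l)
    where
    branch-neighbour : ∀ {t} → OppositeBranch r t → t ≢ l → Branch t × Edge G r t × t ≢ l
    branch-neighbour t-opp t≢l = proj₁ t-opp , far-branch-adjacent r-branch l-opp r≁l t-opp t≢l , t≢l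

  module NonAdjacentFarPair {a b} (opp : side (branch b) ≡ not (side (branch a)))
    (r≁l : ¬ Edge G (branch a) (branch b)) where

    r = branch a
    l = branch b

    a≢b : a ≢ b
    a≢b a≡b = opposite-sides⇒≢ {x = branch a} refl opp (cong branch a≡b)

    others = indices-avoiding₂ a b a≢b 5≤q

    t : Fin 5 → Vtx G
    t = branch ∘ proj₁ others

    t-distinct : ∀ {i j} → i ≢ j → t i ≢ t j
    t-distinct i≢j = i≢j ∘ proj₁ (proj₂ others) ∘ branch-injective

    t≢r : ∀ i → t i ≢ r
    t≢r i = proj₁ (proj₂ (proj₂ others)) i ∘ branch-injective

    t≢l : ∀ i → t i ≢ l
    t≢l i = proj₂ (proj₂ (proj₂ others)) i ∘ branch-injective

    same-side-impossible : ∀ {i j k} → i ≢ j → i ≢ k → j ≢ k → side (t j) ≡ side (t i) → side (t k) ≡ side (t i) → ⊥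
    same-side-impossible {i} {j} {k} i≢j i≢k j≢k sj sk with side (t i) Boolₚ.≟ side l
    ... | yes si = few-far-branches (a , refl) ((b , refl) , opp) r≁l (t-distinct i≢j) (t-distinct i≢k) (t-distinct j≢k)
      (far i si , t≢l i) (far j (trans sj si) , t≢l j) (far k (trans sk si) , t≢l k)
      where
      far : ∀ n → side (t n) ≡ side l → OppositeBranch r (t n)
      far n sn = (_ , refl) , trans sn opp
    ... | no ¬si = few-far-branches (b , refl) ((a , refl) , opposite-sides opp) (r≁l ∘ Edge-sym)
      (t-distinct i≢j) (t-distinct i≢k) (t-distinct j≢k)
      (far i refl , t≢r i) (far j sj , t≢r j) (far k sk , t≢r k)
      where
      far : ∀ n → side (t n) ≡ side (t i) → OppositeBranch l (t n)
      far n sn = (_ , refl) , trans sn (Boolₚ.¬-not ¬si)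

    impossible : ⊥
    impossible with three-agree (side ∘ t)
    ... | i , j , k , i≢j , i≢k , j≢k , sj , sk = same-side-impossible i≢j i≢k j≢k sj sk

  module AdjacentFarPairs (adjacent : ∀ a b → side (branch b) ≡ not (side (branch a)) → Edge G (branch a) (branch b)) where

    far-adjacent : ∀ {r x} → Branch r → OppositeBranch r x → Edge G r x
    far-adjacent (a , refl) ((b , refl) , opp) = adjacent a b opp

    lonely-impossible : ∀ a → Lonely (branch a) → ⊥
    lonely-impossible a lonely with indices-avoiding a (s≤s 2≤q)
    ... | f , f-injective , f≢a = lonely-branch (a , refl) lonely (λ x-opp _ → far-adjacent (a , refl) x-opp)
      (distinct (λ ())) (distinct (λ ())) (distinct (λ ())) (other (# 0)) (other (# 1)) (other (# 2))
      where
      distinct : ∀ {i j} → i ≢ j → branch (f i) ≢ branch (f j)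
      distinct i≢j = i≢j ∘ f-injective ∘ branch-injective
      other : ∀ i → Branch (branch (f i)) × Edge G (branch a) (branch (f i)) × branch (f i) ≢ branch a
      other i = (f i , refl) , far-adjacent (a , refl) ((f i , refl) , opp) , f≢a i ∘ branch-injective
        where
        opp : side (branch (f i)) ≡ not (side (branch a))
        opp = Boolₚ.¬-not (λ same → f≢a i (branch-injective (lonely (f i , refl) same)))

    impossible : ∀ {a b} → side (branch b) ≡ not (side (branch a)) → ⊥
    impossible {a} {b} opp with companion? (branch a) | companion? (branch b)
    ... | no none | _       = lonely-impossible a (¬companion⇒lonely none)
    ... | yes _   | no none = lonely-impossible b (¬companion⇒lonely none)
    ... | yes (u , su , u≢a) | yes (v , sv , v≢b) = v≢b (sym (common-neighbour-unique (u≢a ∘ sym)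
      (adjacent a b opp) (adjacent u b (trans opp (cong not (sym su))))
      (adjacent a v (trans sv opp)) (adjacent u v (trans (trans sv opp) (cong not (sym su))))))

  -- For a non-branch vertex z on the branch side, the common neighbour T u of z and branch u is adjacent to
  -- exactly one other branch vertex σ u; then σ is a fixed-point-free involution of the q + 2 branch vertices.
  module OneSided (same : ∀ u → side (branch u) ≡ side (branch fzero)) where

    s₀ = side (branch fzero)

    far⇒¬branch : ∀ {x} → side x ≡ not s₀ → ¬ Branch x
    far⇒¬branch sx (u , refl) = Boolₚ.not-¬ (same u) sx

    branch-neighbour-far : ∀ {u x} → Edge G (branch u) x → side x ≡ not s₀
    branch-neighbour-far {u} e = trans (edge⇒side-flips e) (cong not (same u))

    branch-neighbours≤2 : ∀ x → AtMostTwo (λ u → Edge G (branch u) x)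
    branch-neighbours≤2 x {u} {v} {w} u≢v u≢w v≢w ux vx wx =
      ¬branch-degree≤2 (branch-nbr∈H u ux) (far⇒¬branch (branch-neighbour-far ux))
        (u≢v ∘ branch-injective) (u≢w ∘ branch-injective) (v≢w ∘ branch-injective)
        (branch∈H u , Edge-sym ux) (branch∈H v , Edge-sym vx) (branch∈H w , Edge-sym wx)

    t = nbr (branch fzero) fzero

    z-edge : ∃[ z ] (Edge G t z × ¬ Branch z)
    z-edge = neighbour-outside 2≤q branch? t (AtMostTwo-mono (λ (tz , bz) → Branch⇒InH bz , tz)
      (¬branch-degree≤2 (branch-nbr∈H fzero (nbr-edge _ _)) (far⇒¬branch (branch-neighbour-far (nbr-edge _ _)))))

    z = proj₁ z-edge
    tz = proj₁ (proj₂ z-edge)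
    ¬bz = proj₂ (proj₂ z-edge)

    side-z : side z ≡ s₀
    side-z = trans (edge⇒side-flips tz)
      (trans (cong not (branch-neighbour-far (nbr-edge _ _))) (Boolₚ.not-involutive s₀))

    z≢branch : ∀ u → z ≢ branch u
    z≢branch u z≡ = ¬bz (u , sym z≡)

    meet-z : ∀ u → ∃[ y ] (Edge G z y × Edge G (branch u) y)
    meet-z u = common-neighbour (z≢branch u) (trans side-z (sym (same u)))

    T : Fin (suc (suc q)) → Vtx G
    T u = proj₁ (meet-z u)

    meet : ∀ u i → ∃[ y ] (Edge G (branch u) y × Edge G (branch (punchIn u i)) y)
    meet u i = common-neighbour (Finₚ.punchInᵢ≢i u i ∘ sym ∘ branch-injective) (trans (same u) (sym (same _)))

    meet-injective : ∀ u → Injective _≡_ _≡_ (proj₁ ∘ meet u)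
    meet-injective u {i} {j} eq = decidable-stable (i Finₚ.≟ j) λ i≢j → branch-neighbours≤2 (proj₁ (meet u i))
      (Finₚ.punchInᵢ≢i u i ∘ sym) (Finₚ.punchInᵢ≢i u j ∘ sym) (i≢j ∘ Finₚ.punchIn-injective u i j)
      (proj₁ (proj₂ (meet u i))) (proj₂ (proj₂ (meet u i))) (subst (Edge G _) (sym eq) (proj₂ (proj₂ (meet u j))))

    partner : ∀ u → ∃[ v ] (v ≢ u × Edge G (branch v) (T u))
    partner u = punchIn u i , Finₚ.punchInᵢ≢i u i , subst (Edge G _) (proj₂ hit) (proj₂ (proj₂ (meet u i)))
      where
      hit = neighbours-saturated neighbours (proj₁ ∘ meet u) (meet-injective u) (proj₁ ∘ proj₂ ∘ meet u)
              (proj₂ (proj₂ (meet-z u)))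
      i = proj₁ hit

    σ : Fin (suc (suc q)) → Fin (suc (suc q))
    σ u = proj₁ (partner u)

    σ≢id : ∀ u → σ u ≢ u
    σ≢id u = proj₁ (proj₂ (partner u))

    partner-unique : ∀ {u v} → v ≢ u → Edge G (branch v) (T u) → v ≡ σ u
    partner-unique {u} {v} v≢u e = decidable-stable (v Finₚ.≟ σ u) λ v≢σu →
      branch-neighbours≤2 (T u) (v≢u ∘ sym) (σ≢id u ∘ sym) v≢σu
        (proj₂ (proj₂ (meet-z u))) e (proj₂ (proj₂ (partner u)))

    T∘σ : ∀ u → T (σ u) ≡ T u
    T∘σ u = common-neighbour-unique (z≢branch (σ u)) (proj₁ (proj₂ (meet-z (σ u)))) (proj₂ (proj₂ (meet-z (σ u))))
      (proj₁ (proj₂ (meet-z u))) (proj₂ (proj₂ (partner u)))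

    σ-involutive : ∀ u → σ (σ u) ≡ u
    σ-involutive u = sym (partner-unique (σ≢id u ∘ sym)
      (subst (Edge G (branch u)) (sym (T∘σ u)) (proj₂ (proj₂ (meet-z u)))))

    impossible : Odd q → ⊥
    impossible q-odd = even⇒¬odd (fixedPointFree-involution⇒even σ σ-involutive σ≢id) (odd⇒odd+2 q-odd)

  impossible : Odd q → ⊥
  impossible odd with Finₚ.any? (λ u → ¬? (side (branch u) Boolₚ.≟ side (branch fzero)))
  ... | no none = OneSided.impossible same odd
    where
    same : ∀ u → side (branch u) ≡ side (branch fzero)
    same u = decidable-stable (side (branch u) Boolₚ.≟ _) (λ differs → none (u , differs))
  ... | yes (b , differs) with Finₚ.any? (λ a → Finₚ.any? (λ b →
          (side (branch b) Boolₚ.≟ not (side (branch a))) ×-dec ¬? (Edge? (branch a) (branch b))))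
  ...   | yes (a , b , opp , r≁l) = NonAdjacentFarPair.impossible opp r≁l
  ...   | no none = AdjacentFarPairs.impossible adjacent (Boolₚ.¬-not differs)
    where
    adjacent : ∀ a b → side (branch b) ≡ not (side (branch a)) → Edge G (branch a) (branch b)
    adjacent a b opp = decidable-stable (Edge? (branch a) (branch b)) (λ r≁l → none (a , b , opp , r≁l))

module PolarPlanes where

  open import Data.Nat using (ℕ; suc; _*_)
  open import Data.Fin using (Fin)
  import Data.Fin.Properties as Finₚ
  open import Data.Bool using (Bool; true; false; not)
  import Data.Bool.Properties as Boolₚ
  open import Data.Product using (∃-syntax; _×_; _,_; proj₁; proj₂)
  import Data.Product.Properties as Productₚ
  open import Data.Product.Function.NonDependent.Propositional using (_×-↔_)
  open import Function using (_∘_; _↔_; Inverse; mk⇔)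
  open import Function.Definitions using (Injective)
  open import Function.Properties.Inverse using (↔-sym; ↔-trans)
  open import Relation.Nullary using (Dec; yes; does)
  open import Relation.Nullary.Decidable using (dec-true; does-⇔)
  open import Relation.Binary.PropositionalEquality
    using (_≡_; _≢_; refl; sym; trans; cong; cong₂; subst; module ≡-Reasoning)

  -- A projective plane of order q together with a polarity: lines are named by their poles, so incidence
  -- becomes a symmetric relation on the points.
  record PolarPlane (X : Set) (q : ℕ) : Set₁ where
    field
      Incident        : X → X → Set
      incident?       : ∀ x y → Dec (Incident x y)
      incident-sym    : ∀ {x y} → Incident x y → Incident y x
      line            : X → Fin (suc q) → X
      line-incident   : ∀ x i → Incident x (line x i)
      line-injective  : ∀ x → Injective _≡_ _≡_ (line x)
      line-surjective : ∀ {x y} → Incident x y → ∃[ i ] line x i ≡ y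
      meet            : ∀ {x y} → x ≢ y → ∃[ z ] (Incident x z × Incident y z)
      meet-unique     : ∀ {x y z w} → x ≢ y → Incident x z → Incident y z → Incident x w → Incident y w → z ≡ w

  module IncidenceGraph {X : Set} {q n : ℕ} (Π : PolarPlane X q) (enc : X ↔ Fin n) where

    open PolarPlane Π

    V : Set
    V = Bool × X

    V↔ : V ↔ Fin (2 * n)
    V↔ = ↔-trans (↔-sym Finₚ.2↔Bool ×-↔ enc) (↔-sym Finₚ.*↔×)

    open Inverse V↔ using (to; from; strictlyInverseˡ; strictlyInverseʳ)

    does-sym : ∀ x y → does (incident? x y) ≡ does (incident? y x)
    does-sym x y = does-⇔ (mk⇔ incident-sym incident-sym) (incident? x y) (incident? y x)

    adjV : V → V → Bool
    adjV (false , x) (true  , y) = does (incident? x y)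
    adjV (true  , x) (false , y) = does (incident? x y)
    adjV _           _           = false

    adjV-sym : ∀ u v → adjV u v ≡ adjV v u
    adjV-sym (false , x) (false , y) = refl
    adjV-sym (false , x) (true  , y) = does-sym x y
    adjV-sym (true  , x) (false , y) = does-sym x y
    adjV-sym (true  , x) (true  , y) = refl

    adjV-irrefl : ∀ u → adjV u u ≡ false
    adjV-irrefl (false , x) = refl
    adjV-irrefl (true  , x) = refl

    graph : Graph
    graph = record
      { n          = 2 * n
      ; adj        = λ i j → adjV (from i) (from j)
      ; adj-sym    = λ i j → adjV-sym (from i) (from j)
      ; adj-irrefl = λ i → adjV-irrefl (from i)
      }

    vertex : V → Vtx graph
    vertex = to

    side : Vtx graph → Bool
    side = proj₁ ∘ from

    point : Vtx graph → X
    point = proj₂ ∘ from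

    does⇒incident : ∀ {x y} → does (incident? x y) ≡ true → Incident x y
    does⇒incident {x} {y} e with incident? x y
    ... | yes ixy = ixy

    adjV⇒ : ∀ u v → adjV u v ≡ true → proj₁ v ≡ not (proj₁ u) × Incident (proj₂ u) (proj₂ v)
    adjV⇒ (false , x) (true  , y) e = refl , does⇒incident e
    adjV⇒ (true  , x) (false , y) e = refl , does⇒incident e

    adjV⇐ : ∀ u v → proj₁ v ≡ not (proj₁ u) → Incident (proj₂ u) (proj₂ v) → adjV u v ≡ true
    adjV⇐ (false , x) (true  , y) _ ixy = dec-true (incident? x y) ixy
    adjV⇐ (true  , x) (false , y) _ ixy = dec-true (incident? x y) ixy

    edge⇒incident : ∀ {i j} → Edge graph i j → Incident (point i) (point j)
    edge⇒incident {i} {j} = proj₂ ∘ adjV⇒ (from i) (from j)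

    to-edge : ∀ {i} x → Incident (point i) x → Edge graph i (to (not (side i) , x))
    to-edge {i} x ixy rewrite strictlyInverseʳ (not (side i) , x) = adjV⇐ (from i) _ refl ixy

    from-injective : ∀ {i j} → from i ≡ from j → i ≡ j
    from-injective {i} {j} eq = trans (sym (strictlyInverseˡ i)) (trans (cong to eq) (strictlyInverseˡ j))

    vertex-≡ : ∀ {i j} → side i ≡ side j → point i ≡ point j → i ≡ j
    vertex-≡ si≡sj pi≡pj = from-injective (Productₚ.×-≡,≡→≡ (si≡sj , pi≡pj))

    neighbours : NeighbourEnumeration graph (suc q)
    neighbours = record
      { nbr            = λ i k → to (not (side i) , line (point i) k)
      ; nbr-edge       = λ i k → to-edge _ (line-incident (point i) k)
      ; nbr-injective  = injective
      ; nbr-surjective = surjective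
      }
      where
      to-injective : ∀ u v → to u ≡ to v → u ≡ v
      to-injective u v eq = trans (sym (strictlyInverseʳ u)) (trans (cong from eq) (strictlyInverseʳ v))
      injective : ∀ i → Injective _≡_ _≡_ (λ k → to (not (side i) , line (point i) k))
      injective i {k} {k′} eq = line-injective (point i)
        (cong proj₂ (to-injective (not (side i) , line (point i) k) (not (side i) , line (point i) k′) eq))
      surjective : ∀ {i j} → Edge graph i j → ∃[ k ] to (not (side i) , line (point i) k) ≡ j
      surjective {i} {j} e with line-surjective (edge⇒incident {i} {j} e)
      ... | k , line≡ = k , (begin
        to (not (side i) , line (point i) k)
          ≡⟨ cong₂ (λ s x → to (s , x)) (sym (proj₁ (adjV⇒ (from i) (from j) e))) line≡ ⟩
        to (from j)                          ≡⟨ strictlyInverseˡ j ⟩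
        j                                    ∎)
        where open ≡-Reasoning

    projectivePlaneGraph : ProjectivePlaneGraph graph q
    projectivePlaneGraph = record
      { side                    = side
      ; edge⇒side-flips         = λ {i} {j} → proj₁ ∘ adjV⇒ (from i) (from j)
      ; neighbours              = neighbours
      ; common-neighbour        = common-neighbour
      ; common-neighbour-unique = common-neighbour-unique
      }
      where
      common-neighbour : ∀ {i j} → i ≢ j → side i ≡ side j → ∃[ k ] (Edge graph i k × Edge graph j k)
      common-neighbour {i} {j} i≢j si≡sj with meet (i≢j ∘ vertex-≡ si≡sj)
      ... | z , iz , jz = to (not (side i) , z) , to-edge z iz ,
        subst (λ s → Edge graph j (to (not s , z))) (sym si≡sj) (to-edge z jz)
      common-neighbour-unique : ∀ {i j k l} → i ≢ j →
        Edge graph i k → Edge graph j k → Edge graph i l → Edge graph j l → k ≡ l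
      common-neighbour-unique {i} {j} {k} {l} i≢j ik jk il jl = vertex-≡
        (trans (proj₁ (adjV⇒ (from i) (from k) ik)) (sym (proj₁ (adjV⇒ (from i) (from l) il))))
        (meet-unique (i≢j ∘ vertex-≡ si≡sj) (edge⇒incident {i} ik) (edge⇒incident {j} jk)
          (edge⇒incident {i} il) (edge⇒incident {j} jl))
        where
        si≡sj : side i ≡ side j
        si≡sj = Boolₚ.not-injective
          (trans (sym (proj₁ (adjV⇒ (from i) (from k) ik))) (proj₁ (adjV⇒ (from j) (from k) jk)))

open PolarPlanes

module Residues (p : ℕ) (p-prime : Prime p) where

  open import Data.Nat as ℕ using (ℕ; NonZero)
  import Data.Nat.DivMod as ℕDivMod
  import Data.Nat.Divisibility as ℕDiv
  open import Data.Nat.Primality using (Prime; euclidsLemma; prime⇒nonZero)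
  open import Data.Integer as ℤ using (ℤ; +_; _+_; _*_; _-_; -_)
  import Data.Integer.Properties as ℤₚ
  open import Data.Integer.Divisibility.Signed using (_∣_; divides; ∣ᵤ⇒∣; ∣⇒∣ᵤ; ∣m∣n⇒∣m-n)
  open import Data.Integer.DivMod using (_%ℕ_; _/ℕ_; n%ℕd<d; a≡a%ℕn+[a/ℕn]*n)
  open import Data.Integer.Tactic.RingSolver using (solve-∀)
  open import Data.Fin using (Fin; toℕ; fromℕ<)
  import Data.Fin.Properties as Finₚ
  open import Data.Product using (∃-syntax; _,_; proj₁; proj₂)
  open import Data.Sum using (_⊎_; inj₁; inj₂; [_,_]′)
  open import Function.Definitions using (Injective)
  open import Relation.Nullary using (¬_; contradiction)
  open import Relation.Binary.PropositionalEquality using (_≡_; refl; sym; trans; cong; subst; module ≡-Reasoning)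

  instance
    p≢0 : NonZero p
    p≢0 = prime⇒nonZero p-prime

  P : ℤ
  P = + p

  ⟦_⟧ : Fin p → ℤ
  ⟦ x ⟧ = + toℕ x

  reduce : ℤ → Fin p
  reduce z = fromℕ< (n%ℕd<d z p)

  ∣-difference : ∀ {a b c} → P ∣ a → P ∣ b → c ≡ a - b → P ∣ c
  ∣-difference P∣a P∣b refl = ∣m∣n⇒∣m-n P∣a P∣b

  reduce-correct : ∀ z → P ∣ ⟦ reduce z ⟧ - z
  reduce-correct z = divides (- (z /ℕ p)) (begin
    ⟦ reduce z ⟧ - z                              ≡⟨ cong (λ r → + r - z) (Finₚ.toℕ-fromℕ< (n%ℕd<d z p)) ⟩
    + (z %ℕ p) - z                                ≡⟨ cong (λ w → + (z %ℕ p) - w) (a≡a%ℕn+[a/ℕn]*n z p) ⟩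
    + (z %ℕ p) - (+ (z %ℕ p) + (z /ℕ p) * P)      ≡⟨ cancel (+ (z %ℕ p)) (z /ℕ p) P ⟩
    - (z /ℕ p) * P                                ∎)
    where
    open ≡-Reasoning
    cancel : ∀ r d P → r - (r + d * P) ≡ - d * P
    cancel = solve-∀

  ⟦⟧-injective : ∀ {x y} → P ∣ ⟦ x ⟧ - ⟦ y ⟧ → x ≡ y
  ⟦⟧-injective {x} {y} P∣x-y = Finₚ.toℕ-injective (ℤₚ.+-injective (ℤₚ.i-j≡0⇒i≡j _ _ (ℤₚ.∣i∣≡0⇒i≡0 ∣x-y∣≡0)))
    where
    ∣x-y∣<p : ℤ.∣ ⟦ x ⟧ - ⟦ y ⟧ ∣ ℕ.< p
    ∣x-y∣<p = ℕₚ.≤-<-trans (subst (ℕ._≤ toℕ x ℕ.⊔ toℕ y) (cong ℤ.∣_∣ (sym (ℤₚ.[+m]-[+n]≡m⊖n (toℕ x) (toℕ y))))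
      (ℤₚ.∣m⊝n∣≤m⊔n (toℕ x) (toℕ y))) (ℕₚ.⊔-lub (Finₚ.toℕ<n x) (Finₚ.toℕ<n y))
    ∣x-y∣≡0 : ℤ.∣ ⟦ x ⟧ - ⟦ y ⟧ ∣ ≡ 0
    ∣x-y∣≡0 = trans (sym (ℕDivMod.m<n⇒m%n≡m ∣x-y∣<p)) (ℕDiv.n∣m⇒m%n≡0 _ p (∣⇒∣ᵤ P∣x-y))

  reduce-unique : ∀ {x} z → P ∣ ⟦ x ⟧ - z → reduce z ≡ x
  reduce-unique {x} z P∣x-z = ⟦⟧-injective (∣-difference (reduce-correct z) P∣x-z (shift ⟦ reduce z ⟧ ⟦ x ⟧ z))
    where
    shift : ∀ r x z → r - x ≡ (r - z) - (x - z)
    shift = solve-∀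

  reduce-≡⇒∣ : ∀ a b → reduce a ≡ reduce b → P ∣ a - b
  reduce-≡⇒∣ a b eq = ∣-difference (reduce-correct b) (reduce-correct a)
    (subst (λ r → a - b ≡ (⟦ r ⟧ - b) - (⟦ reduce a ⟧ - a)) eq (shift ⟦ reduce a ⟧ a b))
    where
    shift : ∀ r a b → a - b ≡ (r - b) - (r - a)
    shift = solve-∀

  euclid : ∀ a b → P ∣ a * b → P ∣ a ⊎ P ∣ b
  euclid a b P∣ab with euclidsLemma ℤ.∣ a ∣ ℤ.∣ b ∣ p-prime (subst (p ℕDiv.∣_) (ℤₚ.abs-* a b) (∣⇒∣ᵤ P∣ab))
  ... | inj₁ p∣a = inj₁ (∣ᵤ⇒∣ p∣a)
  ... | inj₂ p∣b = inj₂ (∣ᵤ⇒∣ p∣b)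

  inverse : ∀ c → ¬ P ∣ c → ∃[ v ] P ∣ c * ⟦ v ⟧ - + 1
  inverse c P∤c = proj₁ hit , reduce-≡⇒∣ (c * ⟦ proj₁ hit ⟧) (+ 1) (proj₂ hit)
    where
    factor : ∀ c x y → c * x - c * y ≡ c * (x - y)
    factor = solve-∀
    multiply-injective : Injective _≡_ _≡_ (λ x → reduce (c * ⟦ x ⟧))
    multiply-injective {x} {y} eq = [ (λ P∣c → contradiction P∣c P∤c) , ⟦⟧-injective ]′
      (euclid c (⟦ x ⟧ - ⟦ y ⟧) (subst (P ∣_) (factor c ⟦ x ⟧ ⟦ y ⟧) (reduce-≡⇒∣ (c * ⟦ x ⟧) (c * ⟦ y ⟧) eq)))
    hit : ∃[ v ] reduce (c * ⟦ v ⟧) ≡ reduce (+ 1)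
    hit = injective⇒surjective multiply-injective (reduce (+ 1))

module PlaneOverPrimeField (p : ℕ) (p-prime : Prime p) where

  open import Data.Nat as ℕ using (ℕ; suc)
  open import Data.Nat.Primality using (Prime)
  open import Data.Integer using (+_; _+_; _*_; _-_; -_)
  open import Data.Integer.Divisibility.Signed using (_∣_; _∣?_; ∣m∣n⇒∣m+n; ∣n⇒∣m*n)
  open import Data.Integer.Tactic.RingSolver using (solve-∀)
  open import Data.Fin using (Fin) renaming (zero to fzero; suc to fsuc)
  import Data.Fin.Properties as Finₚ
  open import Data.Product using (∃-syntax; _×_; _,_; proj₁; proj₂)
  open import Data.Sum using (_⊎_; inj₁; inj₂; [_,_]′)
  open import Data.Sum.Function.Propositional using (_⊎-↔_)
  open import Data.Unit using (⊤; tt)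
  open import Data.Empty using (⊥; ⊥-elim)
  open import Function using (_∘_; _↔_; mk↔ₛ′)
  open import Function.Properties.Inverse using (↔-sym; ↔-trans; ↔-refl)
  open import Relation.Nullary using (Dec; yes; no)
  import Relation.Nullary.Decidable as Dec
  open import Relation.Binary.PropositionalEquality using (_≡_; _≢_; refl; sym; cong; cong₂; subst)

  open Residues p p-prime

  data Point : Set where
    A : Fin p → Fin p → Point
    B : Fin p → Point
    C : Point

  -- A record rather than the bare divisibility, so that unification recovers a, b, m and k.
  record AffineIncident (a b m k : Fin p) : Set where
    constructor affine-incident
    field divisible : P ∣ ⟦ b ⟧ + ⟦ k ⟧ - ⟦ a ⟧ * ⟦ m ⟧

  open AffineIncident

  -- In homogeneous coordinates A a b = (a : b : 1), B c = (1 : c : 0) and C = (0 : 1 : 0); x and y are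
  -- incident iff x₁y₁ - x₂y₃ - x₃y₂ ≡ 0, a nondegenerate symmetric bilinear form (so y lies on the polar of x).
  Incident : Point → Point → Set
  Incident (A a b) (A m k) = AffineIncident a b m k
  Incident (A a _) (B c)   = a ≡ c
  Incident (A _ _) C       = ⊥
  Incident (B c)   (A a _) = c ≡ a
  Incident (B _)   (B _)   = ⊥
  Incident (B _)   C       = ⊤
  Incident C       (A _ _) = ⊥
  Incident C       (B _)   = ⊤
  Incident C       C       = ⊤

  incident? : ∀ x y → Dec (Incident x y)
  incident? (A a b) (A m k) = Dec.map′ affine-incident divisible (P ∣? _)
  incident? (A a _) (B c)   = a Finₚ.≟ c
  incident? (A _ _) C       = no λ ()
  incident? (B c)   (A a _) = c Finₚ.≟ a
  incident? (B _)   (B _)   = no λ ()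
  incident? (B _)   C       = yes tt
  incident? C       (A _ _) = no λ ()
  incident? C       (B _)   = yes tt
  incident? C       C       = yes tt

  incident-sym : ∀ {x y} → Incident x y → Incident y x
  incident-sym {A a b} {A m k} (affine-incident P∣) =
    affine-incident (subst (P ∣_) (swap-roles ⟦ a ⟧ ⟦ b ⟧ ⟦ m ⟧ ⟦ k ⟧) P∣)
    where
    swap-roles : ∀ a b m k → b + k - a * m ≡ k + b - m * a
    swap-roles = solve-∀
  incident-sym {A _ _} {B _} = sym
  incident-sym {B _}   {A _ _} = sym
  incident-sym {B _}   {C}   _ = tt
  incident-sym {C}     {B _} _ = tt
  incident-sym {C}     {C}   _ = tt

  same-intercept : ∀ {a b b′ m k} → Incident (A a b) (A m k) → Incident (A a b′) (A m k) → b ≡ b′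
  same-intercept {a} {b} {b′} {m} {k} i i′ =
    ⟦⟧-injective (∣-difference (divisible i) (divisible i′) (difference ⟦ a ⟧ ⟦ b ⟧ ⟦ b′ ⟧ ⟦ m ⟧ ⟦ k ⟧))
    where
    difference : ∀ a b b′ m k → b - b′ ≡ (b + k - a * m) - (b′ + k - a * m)
    difference = solve-∀

  A-injective : ∀ {a b a′ b′} → A a b ≡ A a′ b′ → a ≡ a′ × b ≡ b′
  A-injective refl = refl , refl

  private
    expand : ∀ a a′ b b′ m m′ k k′ → (a - a′) * (m - m′) ≡
      ((b′ + k - a′ * m) - (b + k - a * m)) - ((b′ + k′ - a′ * m′) - (b + k′ - a * m′))
    expand = solve-∀

  affine-cross : ∀ {a b a′ b′ m k m′ k′} →
    Incident (A a b) (A m k) → Incident (A a′ b′) (A m k) → Incident (A a b) (A m′ k′) → Incident (A a′ b′) (A m′ k′) →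
    P ∣ (⟦ a ⟧ - ⟦ a′ ⟧) * (⟦ m ⟧ - ⟦ m′ ⟧)
  affine-cross {a} {b} {a′} {b′} {m} {k} {m′} {k′} xz yz xw yw =
    ∣-difference (∣-difference (divisible yz) (divisible xz) refl) (∣-difference (divisible yw) (divisible xw) refl)
      (expand ⟦ a ⟧ ⟦ a′ ⟧ ⟦ b ⟧ ⟦ b′ ⟧ ⟦ m ⟧ ⟦ m′ ⟧ ⟦ k ⟧ ⟦ k′ ⟧)

  affine-unique : ∀ {a b a′ b′ m k m′ k′} → A a b ≢ A a′ b′ →
    Incident (A a b) (A m k) → Incident (A a′ b′) (A m k) → Incident (A a b) (A m′ k′) → Incident (A a′ b′) (A m′ k′) →
    A m k ≡ A m′ k′
  affine-unique {a} {b} {a′} {b′} {m} {k} {m′} {k′} x≢y xz yz xw yw =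
    [ if-a≡a′ , if-m≡m′ ]′ (euclid _ _ (affine-cross xz yz xw yw))
    where
    if-a≡a′ : P ∣ ⟦ a ⟧ - ⟦ a′ ⟧ → A m k ≡ A m′ k′
    if-a≡a′ P∣a-a′ = ⊥-elim (x≢y (cong₂ A a≡a′
      (same-intercept xz (subst (λ c → Incident (A c b′) (A m k)) (sym a≡a′) yz))))
      where
      a≡a′ = ⟦⟧-injective P∣a-a′
    if-m≡m′ : P ∣ ⟦ m ⟧ - ⟦ m′ ⟧ → A m k ≡ A m′ k′
    if-m≡m′ P∣m-m′ = cong₂ A m≡m′
      (same-intercept (incident-sym xz) (subst (λ c → Incident (A c k′) (A a b)) (sym m≡m′) (incident-sym xw)))
      where
      m≡m′ = ⟦⟧-injective P∣m-m′

  unique-AA : ∀ {a b a′ b′ z w} → A a b ≢ A a′ b′ → Incident (A a b) z → Incident (A a′ b′) z →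
    Incident (A a b) w → Incident (A a′ b′) w → z ≡ w
  unique-AA {z = A _ _} {A _ _} x≢y xz yz xw yw = affine-unique x≢y xz yz xw yw
  unique-AA {a} {z = A _ _} {B _} x≢y xz yz refl refl = ⊥-elim (x≢y (cong (A a) (same-intercept xz yz)))
  unique-AA {a} {z = B _} {A _ _} x≢y refl refl xw yw = ⊥-elim (x≢y (cong (A a) (same-intercept xw yw)))
  unique-AA {z = B _} {B _} _ refl _ refl _ = refl
  unique-AA {z = A _ _} {C} _ _ _ () _
  unique-AA {z = B _}   {C} _ _ _ () _
  unique-AA {z = C} _ () _ _ _

  unique-AB : ∀ {a b c z w} → Incident (A a b) z → Incident (B c) z → Incident (A a b) w → Incident (B c) w → z ≡ w
  unique-AB {c = c} {A _ _} {A _ _} xz refl xw refl = cong (A c) (same-intercept (incident-sym xz) (incident-sym xw))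
  unique-AB {z = A _ _} {B _} _ _ _ ()
  unique-AB {z = A _ _} {C}   _ _ () _
  unique-AB {z = B _} _ () _ _
  unique-AB {z = C}   () _ _ _

  unique-AC : ∀ {a b z w} → Incident (A a b) z → Incident C z → Incident (A a b) w → Incident C w → z ≡ w
  unique-AC {z = A _ _} _ () _ _
  unique-AC {z = B _} {A _ _} _ _ _ ()
  unique-AC {z = B _} {B _} refl _ refl _ = refl
  unique-AC {z = B _} {C}   _ _ () _
  unique-AC {z = C} () _ _ _

  unique-BB : ∀ {c c′ z w} → B c ≢ B c′ →
    Incident (B c) z → Incident (B c′) z → Incident (B c) w → Incident (B c′) w → z ≡ w
  unique-BB {z = A _ _} x≢y refl refl _ _ = ⊥-elim (x≢y refl)
  unique-BB {z = B _} _ () _ _ _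
  unique-BB {z = C} {A _ _} x≢y _ _ refl refl = ⊥-elim (x≢y refl)
  unique-BB {z = C} {B _} _ _ _ () _
  unique-BB {z = C} {C}   _ _ _ _ _ = refl

  unique-BC : ∀ {c z w} → Incident (B c) z → Incident C z → Incident (B c) w → Incident C w → z ≡ w
  unique-BC {z = A _ _} _ () _ _
  unique-BC {z = B _} () _ _ _
  unique-BC {z = C} {A _ _} _ _ _ ()
  unique-BC {z = C} {B _}   _ _ () _
  unique-BC {z = C} {C}     _ _ _ _ = refl

  meet-unique : ∀ {x y z w} → x ≢ y → Incident x z → Incident y z → Incident x w → Incident y w → z ≡ w
  meet-unique {A _ _} {A _ _} x≢y xz yz xw yw = unique-AA x≢y xz yz xw yw
  meet-unique {A _ _} {B _}   _   xz yz xw yw = unique-AB xz yz xw yw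
  meet-unique {A _ _} {C}     _   xz yz xw yw = unique-AC xz yz xw yw
  meet-unique {B _}   {A _ _} _   xz yz xw yw = unique-AB yz xz yw xw
  meet-unique {B _}   {B _}   x≢y xz yz xw yw = unique-BB x≢y xz yz xw yw
  meet-unique {B _}   {C}     _   xz yz xw yw = unique-BC xz yz xw yw
  meet-unique {C}     {A _ _} _   xz yz xw yw = unique-AC yz xz yw xw
  meet-unique {C}     {B _}   _   xz yz xw yw = unique-BC yz xz yw xw
  meet-unique {C}     {C}     x≢y _  _  _  _  = ⊥-elim (x≢y refl)

  line : Point → Fin (suc p) → Point
  line (A a b) fzero    = B a
  line (A a b) (fsuc m) = A m (reduce (⟦ a ⟧ * ⟦ m ⟧ - ⟦ b ⟧))
  line (B c)   fzero    = C
  line (B c)   (fsuc k) = A c k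
  line C       fzero    = C
  line C       (fsuc c) = B c

  on-line : ∀ {a b m k} → P ∣ ⟦ k ⟧ - (⟦ a ⟧ * ⟦ m ⟧ - ⟦ b ⟧) → Incident (A a b) (A m k)
  on-line {a} {b} {m} {k} = affine-incident ∘ subst (P ∣_) (rearrange ⟦ a ⟧ ⟦ b ⟧ ⟦ m ⟧ ⟦ k ⟧)
    where
    rearrange : ∀ a b m k → k - (a * m - b) ≡ b + k - a * m
    rearrange = solve-∀

  line-incident : ∀ x i → Incident x (line x i)
  line-incident (A a b) fzero    = refl
  line-incident (A a b) (fsuc m) = on-line (reduce-correct (⟦ a ⟧ * ⟦ m ⟧ - ⟦ b ⟧))
  line-incident (B c)   fzero    = tt
  line-incident (B c)   (fsuc k) = refl
  line-incident C       fzero    = tt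
  line-incident C       (fsuc c) = tt

  line-injective : ∀ x {i j} → line x i ≡ line x j → i ≡ j
  line-injective (A a b) {fzero}  {fzero}  _  = refl
  line-injective (A a b) {fsuc _} {fsuc _} eq = cong fsuc (proj₁ (A-injective eq))
  line-injective (B c)   {fzero}  {fzero}  _  = refl
  line-injective (B c)   {fsuc _} {fsuc _} eq = cong fsuc (proj₂ (A-injective eq))
  line-injective C       {fzero}  {fzero}  _  = refl
  line-injective C       {fsuc _} {fsuc _} refl = refl
  line-injective (A a b) {fzero}  {fsuc _} ()
  line-injective (A a b) {fsuc _} {fzero}  ()
  line-injective (B c)   {fzero}  {fsuc _} ()
  line-injective (B c)   {fsuc _} {fzero}  ()
  line-injective C       {fzero}  {fsuc _} ()
  line-injective C       {fsuc _} {fzero}  ()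

  line-surjective : ∀ {x y} → Incident x y → ∃[ i ] line x i ≡ y
  line-surjective {A a b} {A m k} x~y = fsuc m , cong (A m)
    (reduce-unique (⟦ a ⟧ * ⟦ m ⟧ - ⟦ b ⟧) (subst (P ∣_) (rearrange ⟦ a ⟧ ⟦ b ⟧ ⟦ m ⟧ ⟦ k ⟧) (divisible x~y)))
    where
    rearrange : ∀ a b m k → b + k - a * m ≡ k - (a * m - b)
    rearrange = solve-∀
  line-surjective {A _ _} {B _}   refl = fzero , refl
  line-surjective {B _}   {A _ k} refl = fsuc k , refl
  line-surjective {B _}   {C}     _    = fzero , refl
  line-surjective {C}     {B c}   _    = fsuc c , refl
  line-surjective {C}     {C}     _    = fzero , refl

  -- m = (b - b′) / (a - a′) and k = a m - b solve b + k = a m and b′ + k = a′ m.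
  affine-meet : ∀ {a a′} b b′ → a ≢ a′ → ∃[ z ] (Incident (A a b) z × Incident (A a′ b′) z)
  affine-meet {a} {a′} b b′ a≢a′ = A m k , on-line (reduce-correct (⟦ a ⟧ * ⟦ m ⟧ - ⟦ b ⟧)) , on-line P∣k-[a′m-b′]
    where
    slope-inverse = inverse (⟦ a ⟧ - ⟦ a′ ⟧) (a≢a′ ∘ ⟦⟧-injective)
    v = proj₁ slope-inverse
    m = reduce ((⟦ b ⟧ - ⟦ b′ ⟧) * ⟦ v ⟧)
    k = reduce (⟦ a ⟧ * ⟦ m ⟧ - ⟦ b ⟧)
    solution : ∀ a a′ b b′ v m k →
      (k - (a * m - b)) + (a - a′) * (m - (b - b′) * v) + (b - b′) * ((a - a′) * v - + 1) ≡ k - (a′ * m - b′)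
    solution = solve-∀
    P∣k-[a′m-b′] : P ∣ ⟦ k ⟧ - (⟦ a′ ⟧ * ⟦ m ⟧ - ⟦ b′ ⟧)
    P∣k-[a′m-b′] = subst (P ∣_) (solution ⟦ a ⟧ ⟦ a′ ⟧ ⟦ b ⟧ ⟦ b′ ⟧ ⟦ v ⟧ ⟦ m ⟧ ⟦ k ⟧)
      (∣m∣n⇒∣m+n (∣m∣n⇒∣m+n (reduce-correct (⟦ a ⟧ * ⟦ m ⟧ - ⟦ b ⟧))
        (∣n⇒∣m*n (⟦ a ⟧ - ⟦ a′ ⟧) (reduce-correct ((⟦ b ⟧ - ⟦ b′ ⟧) * ⟦ v ⟧))))
        (∣n⇒∣m*n (⟦ b ⟧ - ⟦ b′ ⟧) (proj₂ slope-inverse)))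

  meet-AA : ∀ {a a′} b b′ → ∃[ z ] (Incident (A a b) z × Incident (A a′ b′) z)
  meet-AA {a} {a′} b b′ with a Finₚ.≟ a′
  ... | yes refl  = B a , refl , refl
  ... | no  a≢a′ = affine-meet b b′ a≢a′

  meet : ∀ {x y} → x ≢ y → ∃[ z ] (Incident x z × Incident y z)
  meet {A _ b} {A _ b′} _   = meet-AA b b′
  meet {A a b} {B c}    _   = line (A a b) (fsuc c) , line-incident (A a b) (fsuc c) , refl
  meet {A a _} {C}      _   = B a , refl , tt
  meet {B c}   {A a b}  _   = line (A a b) (fsuc c) , refl , line-incident (A a b) (fsuc c)
  meet {B _}   {B _}    _   = C , tt , tt
  meet {B _}   {C}      _   = C , tt , tt
  meet {C}     {A a _}  _   = B a , tt , refl
  meet {C}     {B _}    _   = C , tt , tt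
  meet {C}     {C}      x≢y = ⊥-elim (x≢y refl)

  polarPlane : PolarPlane Point p
  polarPlane = record
    { Incident        = Incident
    ; incident?       = incident?
    ; incident-sym    = incident-sym
    ; line            = line
    ; line-incident   = line-incident
    ; line-injective  = line-injective
    ; line-surjective = line-surjective
    ; meet            = meet
    ; meet-unique     = meet-unique
    }

  Point↔ : Point ↔ Fin (p ℕ.* p ℕ.+ suc p)
  Point↔ = ↔-trans (mk↔ₛ′ split join split-join join-split) (↔-trans (↔-sym Finₚ.*↔× ⊎-↔ ↔-refl) (↔-sym Finₚ.+↔⊎))
    where
    split : Point → (Fin p × Fin p) ⊎ Fin (suc p)
    split (A a b) = inj₁ (a , b)
    split (B c)   = inj₂ (fsuc c)
    split C       = inj₂ fzero
    join : (Fin p × Fin p) ⊎ Fin (suc p) → Point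
    join (inj₁ (a , b))  = A a b
    join (inj₂ (fsuc c)) = B c
    join (inj₂ fzero)    = C
    split-join : ∀ s → split (join s) ≡ s
    split-join (inj₁ _)        = refl
    split-join (inj₂ (fsuc _)) = refl
    split-join (inj₂ fzero)    = refl
    join-split : ∀ x → join (split x) ≡ x
    join-split (A _ _) = refl
    join-split (B _)   = refl
    join-split C       = refl

module Primes where

  open import Data.Nat using (ℕ; zero; suc; _+_; _≤_; _<_; z≤n; s≤s; _!)
  open import Data.Nat.Divisibility using (_∣_; divides; ∣-trans; ∣1⇒≡1; m∣m*n; ∣m+n∣m⇒∣n; m≤n⇒m!∣n!)
  open import Data.Nat.Primality using (Prime; ¬prime[0]; ¬prime[1]; prime⇒irreducible)
  open import Data.Nat.Primality.Factorisation using (factorise)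
  open import Data.Nat.ListAction using (product)
  open import Data.List using ([]; _∷_)
  open import Data.List.Relation.Unary.All using (_∷_)
  open import Data.Bool using (false)
  open import Data.Product using (∃-syntax; _×_; _,_)
  open import Data.Sum using (inj₁; inj₂; [_,_]′)
  open import Function using (id)
  open import Relation.Nullary using (¬_; contradiction)
  open import Relation.Binary.PropositionalEquality using (sym; trans; subst)

  n∣n! : ∀ {n} → Prime n → n ∣ n !
  n∣n! {zero}  p-prime = contradiction p-prime ¬prime[0]
  n∣n! {suc n} _       = m∣m*n (n !)

  prime-above : ∀ K → ∃[ p ] (Prime p × K < p)
  prime-above K with factorise (suc (K !))
  ... | record { factors = [] ; isFactorisation = 1+K!≡1 } =
    contradiction (sym (ℕₚ.suc-injective 1+K!≡1)) (ℕₚ.<⇒≢ (ℕₚ.1≤n! K))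
  ... | record { factors = p ∷ ps ; isFactorisation = 1+K!≡p*ps ; factorsPrime = p-prime ∷ _ } =
    p , p-prime , ℕₚ.≰⇒> p≰K
    where
    p∣1+K! : p ∣ K ! + 1
    p∣1+K! = divides (product ps) (trans (ℕₚ.+-comm (K !) 1) (trans 1+K!≡p*ps (ℕₚ.*-comm p (product ps))))
    p≰K : ¬ p ≤ K
    p≰K p≤K = ¬prime[1] (subst Prime (∣1⇒≡1 (∣m+n∣m⇒∣n p∣1+K! (∣-trans (n∣n! p-prime) (m≤n⇒m!∣n! p≤K)))) p-prime)

  odd-prime-above : ∀ N → ∃[ p ] (Prime p × 5 + N ≤ p × Odd p)
  odd-prime-above N with prime-above (4 + N)
  ... | p , p-prime , 5+N≤p = p , p-prime , 5+N≤p , [ (λ even → contradiction even ¬even) , id ]′ (even-or-odd p)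
    where
    ¬even : ¬ Even p
    ¬even (k , p≡2k) with prime⇒irreducible p-prime (divides k (trans p≡2k (ℕₚ.*-comm 2 k)))
    ... | inj₁ ()
    ... | inj₂ 2≡p = contradiction (subst (5 + N ≤_) (sym 2≡p) 5+N≤p) λ { (s≤s (s≤s ())) }

open Primes

mainTheorem10 : ∀ (N : ℕ) → ∃[ d ] (N ≤ d × ∃[ G ] (Regular G d × Girth G 6 × ¬ ContainsInducedSubdivision G (complete (suc d))))
mainTheorem10 N with odd-prime-above N
... | p , p-prime , 5+N≤p , p-odd =
  suc p , N≤p+1 , graph , enumeration⇒regular neighbours , girth-6 2≤p (vertex (false , C)) ,
  λ sub → impossible (induced-subdivision-profile neighbours sub) 5≤p p-odd
  where
  open PlaneOverPrimeField p p-prime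
  open IncidenceGraph polarPlane Point↔
  open ProjectivePlaneGraphProperties projectivePlaneGraph using (girth-6)
  open NoInducedSubdivision projectivePlaneGraph using (impossible)
  5≤p : 5 ≤ p
  5≤p = ℕₚ.≤-trans (ℕₚ.m≤m+n 5 N) 5+N≤p
  2≤p : 2 ≤ p
  2≤p = ℕₚ.≤-trans (s≤s (s≤s z≤n)) 5≤p
  N≤p+1 : N ≤ suc p
  N≤p+1 = ℕₚ.≤-trans (ℕₚ.m≤n+m N 5) (ℕₚ.≤-trans 5+N≤p (ℕₚ.n≤1+n p))
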